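{- Order $0\{0,1\}^{n-1}$ lexicographically with $0<1$. For every $\sigma\in0\{0,1\}^{n-1}$ there are integers $c_{\sigma,\tau}$ such that $$F(M_\sigma,\mathbf{x})=\sum_{\tau\le_{lex}\sigma}c_{\sigma,\tau}F(R_\tau,\gamma_\tau,\mathbf{x}),$$ where $\gamma_\tau$ is any strict labelling of the poset $R_\tau$, and the diagonal coefficient is $$c_{\sigma,\sigma}=\prod_{i=1}^t\binom{|A_i|}{z_i},$$ where $(A_1,\ldots,A_t)$ are the blocks of $\sigma$ and $(z_1,\ldots,z_t)$ its associated vector.
   Context: For a matroid $M$ on finite ground set $E$ and $f:E\to\mathbb{P}=\{1,2,\ldots\}$, $f$ is $M$-generic if the minimum of $f(B)=\sum_{e\in B}f(e)$ over bases is attained by a unique base; $F(M,\mathbf{x})=\sum_{f\ M\text{ -generic}}\prod_{e\in E}x_{f(e)}$. $0\{0,1\}^{n-1}$ is the set of binary strings $\sigma=\sigma_1\cdots\sigma_n$ with $\sigma_1=0$. For a matroid $M$ of rank $r$, $I(M)$ is the extension by an isthmus, and $P(M)$ is the principal extension along the improper flat (new element $e$; bases of $P(M)$ are the bases of $M$ together with $J\cup\{e\}$ for independent $J$ of size $r-1$). $M_\sigma$ is obtained from the empty matroid by applying, for $i=1,\ldots,n$, $I$ if $\sigma_i=0$ and $P$ if $\sigma_i=1$. $R_\sigma$ is the poset on $[n]$ with $i<j$ in $R_\sigma$ if and only if $\sigma_i=0$, $\sigma_j=1$ and $i<j$. The blocks $A_1,\ldots,A_t$ of $\sigma$ are the intervals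 of $[n]$ obtained by cutting between positions $i,i+1$ whenever $(\sigma_i,\sigma_{i+1})=(1,0)$; $z_i$ is the number of $j\in A_i$ with $\sigma_j=0$. A labelling $\gamma:P\to[n]$ of a poset $P$ is strict if $\gamma(p)>\gamma(p')$ whenever $p<p'$; a $(P,\gamma)$-partition is $f:P\to\mathbb{P}$ with $f(p)\le f(p')$ when $p\le p'$ and $f(p)<f(p')$ when $p\le p'$ and $\gamma(p)>\gamma(p')$; $F(P,\gamma,\mathbf{x})=\sum_f\prod_px_{f(p)}$ over all $(P,\gamma)$-partitions. -}

module Defs where

open import Data.Bool using (Bool; true; false; _∧_; _∨_; not; if_then_else_; T)
open import Data.Nat using (ℕ; zero; suc; _+_; _*_; _∸_; _≡ᵇ_; _≤ᵇ_; _<ᵇ_)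
open import Data.Nat.Combinatorics using (_C_)
open import Data.Fin as Fin using (Fin; toℕ)
open import Data.List as List using (List; []; _∷_; length; filterᵇ; allFin; upTo; concatMap; foldr; reverse)
open import Data.Bool.ListAction using (all; any)
open import Data.Nat.ListAction using (product)
open import Data.Vec as Vec using (Vec; []; _∷_; lookup)
open import Data.Integer as ℤ using (ℤ)
open import Data.Product using (_×_)
open import Relation.Binary.PropositionalEquality using (_≡_)
open import Function.Definitions using (Injective)

-- Binary strings σ ∈ {0,1}^n are Vec Bool n, with 0 = false, 1 = true.
-- Subsets of the ground set [n] = Fin n are characteristic vectors Vec Bool n.

boolEq : Bool → Bool → Bool
boolEq true  b = b
boolEq false b = not b

card : ∀ {n} → Vec Bool n → ℕ
card []          = 0
card (true ∷ s)  = suc (card s)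
card (false ∷ s) = card s

zeros : ∀ {n} → Vec Bool n → ℕ
zeros []          = 0
zeros (false ∷ s) = suc (zeros s)
zeros (true ∷ s)  = zeros s

subsetᵇ : ∀ {n} → Vec Bool n → Vec Bool n → Bool
subsetᵇ []      []      = true
subsetᵇ (a ∷ s) (b ∷ t) = (not a ∨ b) ∧ subsetᵇ s t

allSubsets : (n : ℕ) → List (Vec Bool n)
allSubsets zero    = [] ∷ []
allSubsets (suc n) = concatMap (λ s → (false ∷ s) ∷ (true ∷ s) ∷ []) (allSubsets n)

-- The matroid M_σ, given by its bases.
-- baseRev ρ S : ρ is σ REVERSED (last applied operation first), and S is the
-- reversed characteristic vector; the head position is the element added last.
-- I(M): bases are B ∪ {e}, B a base of M.
-- P(M): bases are the bases of M, and J ∪ {e} with J independent in M, |J| = r(M) - 1.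
-- Independent = contained in some base. r(M_ρ) = number of isthmus steps = zeros ρ.

mutual
  baseRev : ∀ {n} → Vec Bool n → Vec Bool n → Bool
  baseRev []          []          = true
  baseRev (false ∷ ρ) (true ∷ S)  = baseRev ρ S
  baseRev (false ∷ ρ) (false ∷ S) = false
  baseRev (true ∷ ρ)  (false ∷ S) = baseRev ρ S
  baseRev (true ∷ ρ)  (true ∷ S)  = indepRev ρ S ∧ (suc (card S) ≡ᵇ zeros ρ)

  indepRev : ∀ {n} → Vec Bool n → Vec Bool n → Bool
  indepRev {n} ρ S = any (λ B → baseRev ρ B ∧ subsetᵇ S B) (allSubsets n)

-- B is a base of M_σ (ground set [n], element i added at step i)
isBase : ∀ {n} → Vec Bool n → Vec Bool n → Bool
isBase σ B = baseRev (Vec.reverse σ) (Vec.reverse B)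

-- Functions f : [n] → ℙ are vectors Vec ℕ n with entries ≥ 1.

weight : ∀ {n} → Vec ℕ n → Vec Bool n → ℕ
weight []      []          = 0
weight (x ∷ f) (true ∷ B)  = x + weight f B
weight (x ∷ f) (false ∷ B) = weight f B

genericᵇ : ∀ {n} → Vec Bool n → Vec ℕ n → Bool
genericᵇ {n} σ f =
  length (filterᵇ (λ B → isBase σ B ∧
            all (λ B′ → not (isBase σ B′) ∨ (weight f B ≤ᵇ weight f B′)) (allSubsets n))
          (allSubsets n)) ≡ᵇ 1

-- A monomial x_1^{α_1} ⋯ x_k^{α_k} is the list α = α_1 ∷ ⋯ ∷ α_k ∷ [].
-- The coefficient of x^α in Σ_f ∏_e x_{f(e)} is the number of f : [n] → ℙ
-- (in the class summed over) whose content is α, i.e. |f⁻¹(i)| = α_i for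
-- 1 ≤ i ≤ k and f takes no value > k.

allMaps : (n k : ℕ) → List (Vec ℕ n)
allMaps zero    k = [] ∷ []
allMaps (suc n) k = concatMap (λ f → List.map (λ v → v ∷ f) (List.map suc (upTo k))) (allMaps n k)

countVal : ∀ {n} → ℕ → Vec ℕ n → ℕ
countVal i []      = 0
countVal i (x ∷ f) = if x ≡ᵇ i then suc (countVal i f) else countVal i f

contentAux : ∀ {n} → ℕ → List ℕ → Vec ℕ n → Bool
contentAux i []       f = true
contentAux i (a ∷ as) f = (countVal i f ≡ᵇ a) ∧ contentAux (suc i) as f

hasContent : ∀ {n} → List ℕ → Vec ℕ n → Bool
hasContent α f = contentAux 1 α f

coeffOf : (n : ℕ) → (Vec ℕ n → Bool) → List ℕ → ℕ
coeffOf n p α = length (filterᵇ (λ f → hasContent α f ∧ p f) (allMaps n (length α)))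

coeffM : ∀ {n} → Vec Bool n → List ℕ → ℕ
coeffM {n} σ α = coeffOf n (genericᵇ σ) α

rltᵇ : ∀ {n} → Vec Bool n → Fin n → Fin n → Bool
rltᵇ τ i j = not (lookup τ i) ∧ lookup τ j ∧ (toℕ i <ᵇ toℕ j)

RLt : ∀ {n} → Vec Bool n → Fin n → Fin n → Set
RLt τ i j = T (rltᵇ τ i j)

rleᵇ : ∀ {n} → Vec Bool n → Fin n → Fin n → Bool
rleᵇ τ i j = (toℕ i ≡ᵇ toℕ j) ∨ rltᵇ τ i j

-- γ : R_τ → [n] is a strict labelling: a labelling (bijection [n] → [n];
-- injectivity suffices on Fin n) with γ(p) > γ(p') whenever p < p'.
StrictLabelling : ∀ {n} → Vec Bool n → (Fin n → Fin n) → Set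
StrictLabelling τ γ = Injective _≡_ _≡_ γ × (∀ i j → RLt τ i j → γ j Fin.< γ i)

partitionᵇ : ∀ {n} → Vec Bool n → (Fin n → Fin n) → Vec ℕ n → Bool
partitionᵇ {n} τ γ f =
  all (λ i → all (λ j →
        not (rleᵇ τ i j) ∨
          ((lookup f i ≤ᵇ lookup f j) ∧
           (not (toℕ (γ j) <ᵇ toℕ (γ i)) ∨ (lookup f i <ᵇ lookup f j))))
      (allFin n)) (allFin n)

coeffR : ∀ {n} → Vec Bool n → (Fin n → Fin n) → List ℕ → ℕ
coeffR {n} τ γ α = coeffOf n (partitionᵇ τ γ) α

lexLeqᵇ : ∀ {n} → Vec Bool n → Vec Bool n → Bool
lexLeqᵇ []      []      = true
lexLeqᵇ (a ∷ s) (b ∷ t) = (not a ∧ b) ∨ (boolEq a b ∧ lexLeqᵇ s t)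

startsWith0ᵇ : ∀ {n} → Vec Bool n → Bool
startsWith0ᵇ []      = false
startsWith0ᵇ (a ∷ s) = not a

below : ∀ {n} → Vec Bool n → List (Vec Bool n)
below {n} σ = filterᵇ (λ τ → startsWith0ᵇ τ ∧ lexLeqᵇ τ σ) (allSubsets n)

sumℤ : ∀ {n} → List (Vec Bool n) → (Vec Bool n → ℤ) → ℤ
sumℤ ts g = foldr (λ τ acc → g τ ℤ.+ acc) (ℤ.+ 0) ts

blocksAux : Bool → List Bool → List Bool → List (List Bool)
blocksAux p cur []       = reverse cur ∷ []
blocksAux p cur (y ∷ ys) =
  if p ∧ not y then reverse cur ∷ blocksAux y (y ∷ []) ys
               else blocksAux y (y ∷ cur) ys

blocks : List Bool → List (List Bool)
blocks []       = []
blocks (x ∷ xs) = blocksAux x (x ∷ []) xs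

zerosL : List Bool → ℕ
zerosL = List.length ∘′ filterᵇ not
  where
  _∘′_ : {A B C : Set} → (B → C) → (A → B) → A → C
  (g ∘′ h) x = g (h x)

diagCoeff : ∀ {n} → Vec Bool n → ℕ
diagCoeff σ = product (List.map (λ A → length A C zerosL A) (blocks (Vec.toList σ)))

module Submission where

-- A map f is M_σ-generic exactly when some base B satisfies the local exchange condition
-- f(e) < f(e′) whenever e ∈ B, e′ ∉ B and B − e + e′ is a base; that base is then the unique
-- lightest one.  For M_σ the exchanges are read off a left-to-right scan: the slack (rank of the
-- prefix minus the size of its intersection with B) cuts [n] into blocks, and e, e′ are
-- exchangeable iff the block of e is not after that of e′.  Sorting each block so that the
-- elements of B come first gives a word τ_B, and the local condition becomes strict increase
-- along R_{τ_B}; hence F(M_σ) is the sum over bases B of F(R_{τ_B}, γ), and c_{σ,τ} counts the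
-- bases with τ_B = τ.  Sorting only moves 0s forward, so τ_B ≤lex σ, and τ_B starts with 0 as σ does.
-- Finally τ_B = σ exactly when the slack vanishes at every cut of σ; a block A_i of σ can then
-- meet B in any z_i of its elements, which gives c_{σ,σ} = ∏ binom(|A_i|, z_i).

open import Defs
open import Algebra.Bundles using (CommutativeMonoid)
open import Data.Bool using (Bool; true; false; _∧_; _∨_; not; if_then_else_; T)
open import Data.Bool.ListAction using (all; any)
open import Data.Bool.Properties using (T-≡; ¬-not; ∧-identityʳ; ∧-assoc; ∧-comm; ∧-zeroʳ; ∨-zeroʳ; ∧-isCommutativeMonoid; ∧-commutativeMonoid)
open import Data.Fin using (Fin; zero; suc; toℕ)
open import Data.Fin.Properties using (toℕ-injective)
open import Data.Integer.Properties using (pos-*; pos-+)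
import Data.Integer as ℤ
open import Data.List as List using (List; []; _∷_; _++_; filterᵇ; concatMap; replicate; zip; allFin; upTo)
open import Data.List.Membership.Propositional using (_∈_; lose)
open import Data.List.Membership.Propositional.Properties using (∈-allFin; ∈-concatMap⁺)
open import Data.List.Properties using (++-assoc; unfold-reverse; length-reverse; map-++; map-replicate; length-++; length-replicate)
open import Data.List.Relation.Binary.Permutation.Propositional as ↭ using (_↭_; ↭⇒↭ₛ)
open import Data.List.Relation.Binary.Permutation.Propositional.Properties using (map⁺; shift; ++⁺ˡ; ↭-length)
open import Data.List.Relation.Binary.Permutation.Setoid.Properties using (foldr-commMonoid)
import Data.List.Relation.Unary.All as All
open import Data.List.Relation.Unary.All.Properties using (all⁺; all⁻)
open import Data.List.Relation.Unary.Any as Any using (here; there)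
open import Data.List.Relation.Unary.Any.Properties using (any⁺; any⁻)
open import Data.Maybe using (Maybe; just; nothing; _>>=_)
open import Data.Nat hiding (_*_)
open import Data.Nat.Combinatorics using (_C_; nCk+nC[k+1]≡[n+1]C[k+1])
open import Data.Nat.ListAction using (sum; product)
open import Data.Nat.ListAction.Properties using (sum-↭)
open import Data.Nat.Properties
open import Data.Nat.Tactic.RingSolver using (solve-∀)
open import Data.Product using (_×_; _,_; Σ; ∃; proj₁; proj₂)
open import Data.Sum using (_⊎_; inj₁; inj₂)
open import Data.Vec using (Vec; []; _∷_; head; lookup; reverse; _∷ʳ_; toList; fromList; cast)
open import Data.Vec.Properties using (reverse-∷; reverse-involutive; ∷-injectiveʳ; toList-cast; toList∘fromList)
open import Function using (_∘_)
open import Function.Bundles using (_⇔_; mk⇔; module Equivalence)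
open import Function.Properties.Equivalence using () renaming (trans to ⇔-trans)
open import Relation.Binary.PropositionalEquality
open import Relation.Nullary using (yes; no; contradiction)
open import Induction.WellFounded using (Acc; acc)
open import Data.Nat.Induction using (<-wellFounded)
open import Algebra.Properties.CommutativeSemigroup +-commutativeSemigroup using (interchange; x∙yz≈y∙xz; xy∙z≈y∙xz)
open import Algebra.Properties.CommutativeSemigroup (CommutativeMonoid.commutativeSemigroup ∧-commutativeMonoid) using () renaming (interchange to ∧-interchange)

open Equivalence using (to; from)

module Booleans where

  ∧-true⁻ : ∀ {a b} → a ∧ b ≡ true → a ≡ true × b ≡ true
  ∧-true⁻ {true} {true} _ = refl , refl

  ∧-true⁺ : ∀ {a b} → a ≡ true → b ≡ true → a ∧ b ≡ true
  ∧-true⁺ refl refl = refl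

  pairwise : ∀ {A : Set} → (A → A → Bool) → List A → Bool
  pairwise R []       = true
  pairwise R (x ∷ xs) = all (R x) xs ∧ pairwise R xs

  module _ {A : Set} where

    all-mono : ∀ (p q : A → Bool) xs → (∀ x → p x ≡ true → q x ≡ true) → all p xs ≡ true → all q xs ≡ true
    all-mono p q []       p⇒q _    = refl
    all-mono p q (x ∷ xs) p⇒q allp = ∧-true⁺ (p⇒q x (proj₁ (∧-true⁻ allp))) (all-mono p q xs p⇒q (proj₂ (∧-true⁻ allp)))

    all-++⁺ : ∀ (p : A → Bool) xs {ys} → all p xs ≡ true → all p ys ≡ true → all p (xs ++ ys) ≡ true
    all-++⁺ p []       _    allys = allys
    all-++⁺ p (x ∷ xs) allxs allys = ∧-true⁺ (proj₁ (∧-true⁻ allxs)) (all-++⁺ p xs (proj₂ (∧-true⁻ allxs)) allys)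

    all-replicate⁺ : ∀ (p : A → Bool) k {x} → p x ≡ true → all p (replicate k x) ≡ true
    all-replicate⁺ p zero    px = refl
    all-replicate⁺ p (suc k) px = ∧-true⁺ px (all-replicate⁺ p k px)

  module _ {A : Set} (p : A → Bool) where

    all≡true⇒ : ∀ {x xs} → x ∈ xs → all p xs ≡ true → p x ≡ true
    all≡true⇒ x∈xs allp = to T-≡ (All.lookup (all⁺ p _ (from T-≡ allp)) x∈xs)

    all≡true⇐ : ∀ xs → (∀ x → p x ≡ true) → all p xs ≡ true
    all≡true⇐ xs allp = to T-≡ (all⁻ p (All.universal (λ x → from T-≡ (allp x)) xs))

    any≡true⇐ : ∀ {x xs} → x ∈ xs → p x ≡ true → any p xs ≡ true
    any≡true⇐ x∈xs px = to T-≡ (any⁺ p (lose x∈xs (from T-≡ px)))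

    any≡true⇒ : ∀ xs → any p xs ≡ true → ∃ λ x → p x ≡ true
    any≡true⇒ xs anyp with x , px ← Any.satisfied (any⁻ p xs (from T-≡ anyp)) = x , to T-≡ px

  bool-ext : ∀ {a b} → (a ≡ true ⇔ b ≡ true) → a ≡ b
  bool-ext {false} {false} _   = refl
  bool-ext {false} {true}  a⇔b = from a⇔b refl
  bool-ext {true}  {false} a⇔b = sym (to a⇔b refl)
  bool-ext {true}  {true}  _   = refl

  ≤⇒≤ᵇ≡true : ∀ {m n} → m ≤ n → (m ≤ᵇ n) ≡ true
  ≤⇒≤ᵇ≡true m≤n = to T-≡ (≤⇒≤ᵇ m≤n)

  ≤ᵇ≡true⇒≤ : ∀ {m n} → (m ≤ᵇ n) ≡ true → m ≤ n
  ≤ᵇ≡true⇒≤ {m} {n} e = ≤ᵇ⇒≤ m n (from T-≡ e)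

  >⇒≤ᵇ≡false : ∀ {m n} → n < m → (m ≤ᵇ n) ≡ false
  >⇒≤ᵇ≡false n<m = ¬-not (λ e → <⇒≱ n<m (≤ᵇ≡true⇒≤ e))

  <⇒<ᵇ≡true : ∀ {m n} → m < n → (m <ᵇ n) ≡ true
  <⇒<ᵇ≡true m<n = to T-≡ (<⇒<ᵇ m<n)

  <ᵇ≡true⇒< : ∀ {m n} → (m <ᵇ n) ≡ true → m < n
  <ᵇ≡true⇒< {m} {n} e = <ᵇ⇒< m n (from T-≡ e)

module Counting where
  open import Data.Nat using (_*_)

  𝟙 : Bool → ℕ
  𝟙 true  = 1
  𝟙 false = 0

  𝟙-∧ : ∀ a b → 𝟙 (a ∧ b) ≡ 𝟙 a * 𝟙 b
  𝟙-∧ true  b = sym (+-identityʳ (𝟙 b))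
  𝟙-∧ false b = refl

  𝟙-swap : ∀ a b c → 𝟙 a * 𝟙 (b ∧ c) ≡ 𝟙 b * 𝟙 (a ∧ c)
  𝟙-swap true  true  c = refl
  𝟙-swap true  false c = refl
  𝟙-swap false true  c = refl
  𝟙-swap false false c = refl

  𝟙-≡ᵇ1 : ∀ k → k ≢ 1 → 𝟙 (k ≡ᵇ 1) ≡ 0
  𝟙-≡ᵇ1 zero          _   = refl
  𝟙-≡ᵇ1 (suc zero)    k≢1 = contradiction refl k≢1
  𝟙-≡ᵇ1 (suc (suc k)) _   = refl

  ∑ : {A : Set} → List A → (A → ℕ) → ℕ
  ∑ []       g = 0
  ∑ (x ∷ xs) g = g x + ∑ xs g

  module _ {A : Set} where

    ∑-cong : ∀ xs {g h : A → ℕ} → (∀ x → g x ≡ h x) → ∑ xs g ≡ ∑ xs h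
    ∑-cong []       g≗h = refl
    ∑-cong (x ∷ xs) g≗h = cong₂ _+_ (g≗h x) (∑-cong xs g≗h)

    ∑-zero : ∀ xs (g : A → ℕ) → (∀ x → g x ≡ 0) → ∑ xs g ≡ 0
    ∑-zero []       g g≗0 = refl
    ∑-zero (x ∷ xs) g g≗0 = cong₂ _+_ (g≗0 x) (∑-zero xs g g≗0)

    ∑-++ : ∀ xs ys (g : A → ℕ) → ∑ (xs ++ ys) g ≡ ∑ xs g + ∑ ys g
    ∑-++ []       ys g = refl
    ∑-++ (x ∷ xs) ys g = trans (cong (g x +_) (∑-++ xs ys g)) (sym (+-assoc (g x) _ _))

    ∑-+ : ∀ xs (g h : A → ℕ) → ∑ xs (λ x → g x + h x) ≡ ∑ xs g + ∑ xs h
    ∑-+ []       g h = refl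
    ∑-+ (x ∷ xs) g h = trans (cong (g x + h x +_) (∑-+ xs g h)) (interchange (g x) (h x) _ _)

    ∑-*ˡ : ∀ xs c (g : A → ℕ) → ∑ xs (λ x → c * g x) ≡ c * ∑ xs g
    ∑-*ˡ []       c g = sym (*-zeroʳ c)
    ∑-*ˡ (x ∷ xs) c g = trans (cong (c * g x +_) (∑-*ˡ xs c g)) (sym (*-distribˡ-+ c (g x) _))

    ∑-*ʳ : ∀ xs c (g : A → ℕ) → ∑ xs (λ x → g x * c) ≡ ∑ xs g * c
    ∑-*ʳ xs c g = trans (∑-cong xs (λ x → *-comm (g x) c)) (trans (∑-*ˡ xs c g) (*-comm c _))

    ∑-filterᵇ : ∀ (p : A → Bool) xs g → ∑ (filterᵇ p xs) g ≡ ∑ xs (λ x → 𝟙 (p x) * g x)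
    ∑-filterᵇ p []       g = refl
    ∑-filterᵇ p (x ∷ xs) g with p x
    ... | true  = cong₂ _+_ (sym (+-identityʳ (g x))) (∑-filterᵇ p xs g)
    ... | false = ∑-filterᵇ p xs g

    length-filterᵇ : ∀ (p : A → Bool) xs → List.length (filterᵇ p xs) ≡ ∑ xs (λ x → 𝟙 (p x))
    length-filterᵇ p []       = refl
    length-filterᵇ p (x ∷ xs) with p x
    ... | true  = cong suc (length-filterᵇ p xs)
    ... | false = length-filterᵇ p xs

  module _ {A B : Set} where

    ∑-map : ∀ (h : A → B) xs g → ∑ (List.map h xs) g ≡ ∑ xs (λ x → g (h x))
    ∑-map h []       g = refl
    ∑-map h (x ∷ xs) g = cong (g (h x) +_) (∑-map h xs g)

    ∑-concatMap : ∀ (h : A → List B) xs g → ∑ (concatMap h xs) g ≡ ∑ xs (λ x → ∑ (h x) g)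
    ∑-concatMap h []       g = refl
    ∑-concatMap h (x ∷ xs) g = trans (∑-++ (h x) (concatMap h xs) g) (cong (∑ (h x) g +_) (∑-concatMap h xs g))

    ∑-comm : ∀ (xs : List A) (ys : List B) (g : A → B → ℕ) → ∑ xs (λ x → ∑ ys (g x)) ≡ ∑ ys (λ y → ∑ xs (λ x → g x y))
    ∑-comm []       ys g = sym (∑-zero ys _ (λ _ → refl))
    ∑-comm (x ∷ xs) ys g = trans (cong (∑ ys (g x) +_) (∑-comm xs ys g)) (sym (∑-+ ys (g x) _))

  ∑-allSubsets-∷ : ∀ n (g : Vec Bool (suc n) → ℕ) →
    ∑ (allSubsets (suc n)) g ≡ ∑ (allSubsets n) (λ B → g (false ∷ B)) + ∑ (allSubsets n) (λ B → g (true ∷ B))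
  ∑-allSubsets-∷ n g = begin
    ∑ (concatMap (λ B → (false ∷ B) ∷ (true ∷ B) ∷ []) (allSubsets n)) g
      ≡⟨ ∑-concatMap _ (allSubsets n) g ⟩
    ∑ (allSubsets n) (λ B → g (false ∷ B) + (g (true ∷ B) + 0))
      ≡⟨ ∑-cong (allSubsets n) (λ B → cong (g (false ∷ B) +_) (+-identityʳ _)) ⟩
    ∑ (allSubsets n) (λ B → g (false ∷ B) + g (true ∷ B))
      ≡⟨ ∑-+ (allSubsets n) _ _ ⟩
    ∑ (allSubsets n) (λ B → g (false ∷ B)) + ∑ (allSubsets n) (λ B → g (true ∷ B)) ∎
    where open ≡-Reasoning

  # : ∀ {n} → (Vec Bool n → Bool) → ℕ
  # {n} p = ∑ (allSubsets n) (λ B → 𝟙 (p B))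

  #-∷ : ∀ {n} (p : Vec Bool (suc n) → Bool) → # p ≡ # (λ B → p (false ∷ B)) + # (λ B → p (true ∷ B))
  #-∷ {n} p = ∑-allSubsets-∷ n (λ B → 𝟙 (p B))

  #-none : ∀ {n} (p : Vec Bool n → Bool) → (∀ B → p B ≡ false) → # p ≡ 0
  #-none {n} p none = ∑-zero (allSubsets n) _ (λ B → cong 𝟙 (none B))

  #≡0⇒none : ∀ {n} (p : Vec Bool n → Bool) → # p ≡ 0 → ∀ B → p B ≡ false
  #≡0⇒none {zero}  p #p≡0 [] with p []
  ... | false = refl
  #≡0⇒none {suc n} p #p≡0 (false ∷ B) =
    #≡0⇒none (λ B → p (false ∷ B)) (m+n≡0⇒m≡0 _ (trans (sym (#-∷ p)) #p≡0)) B
  #≡0⇒none {suc n} p #p≡0 (true ∷ B) =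
    #≡0⇒none (λ B → p (true ∷ B)) (m+n≡0⇒n≡0 (# (λ B → p (false ∷ B))) (trans (sym (#-∷ p)) #p≡0)) B

  #≢0⇒witness : ∀ {n} (p : Vec Bool n → Bool) → # p ≢ 0 → ∃ λ B → p B ≡ true
  #≢0⇒witness {zero} p #p≢0 with p [] in e
  ... | true  = [] , e
  ... | false = contradiction refl #p≢0
  #≢0⇒witness {suc n} p #p≢0 with # (λ B → p (false ∷ B)) ≟ 0
  ... | no #p₀≢0 with B , e ← #≢0⇒witness (λ B → p (false ∷ B)) #p₀≢0 = false ∷ B , e
  ... | yes #p₀≡0 with B , e ← #≢0⇒witness (λ B → p (true ∷ B)) (λ #p₁≡0 → #p≢0 (trans (#-∷ p) (cong₂ _+_ #p₀≡0 #p₁≡0))) =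
    true ∷ B , e

  onlyAt⇒false : ∀ {n} (p : Vec Bool n → Bool) {B₀} → (∀ B → p B ≡ true → B ≡ B₀) → ∀ B → B ≢ B₀ → p B ≡ false
  onlyAt⇒false p onlyAt B B≢B₀ = ¬-not (λ pB → B≢B₀ (onlyAt B pB))

  #≡1 : ∀ {n} (p : Vec Bool n → Bool) B₀ → p B₀ ≡ true → (∀ B → p B ≡ true → B ≡ B₀) → # p ≡ 1
  #≡1 p []           pB₀ onlyAt rewrite pB₀ = refl
  #≡1 p (false ∷ B₀) pB₀ onlyAt = trans (#-∷ p) (cong₂ _+_
    (#≡1 (λ B → p (false ∷ B)) B₀ pB₀ (λ B pB → ∷-injectiveʳ (onlyAt _ pB)))
    (#-none (λ B → p (true ∷ B)) (λ B → onlyAt⇒false p onlyAt (true ∷ B) (λ ()))))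
  #≡1 p (true ∷ B₀)  pB₀ onlyAt = trans (#-∷ p) (cong₂ _+_
    (#-none (λ B → p (false ∷ B)) (λ B → onlyAt⇒false p onlyAt (false ∷ B) (λ ())))
    (#≡1 (λ B → p (true ∷ B)) B₀ pB₀ (λ B pB → ∷-injectiveʳ (onlyAt _ pB))))

  #≡1⇒unique : ∀ {n} (p : Vec Bool n → Bool) → # p ≡ 1 → ∃ λ B₀ → p B₀ ≡ true × (∀ B → p B ≡ true → B ≡ B₀)
  #≡1⇒unique {zero} p #p≡1 with p [] in e
  ... | true = [] , e , λ { [] _ → refl }
  #≡1⇒unique {suc n} p #p≡1
    with # (λ B → p (false ∷ B)) in #p₀ | # (λ B → p (true ∷ B)) in #p₁ | trans (sym (#-∷ p)) #p≡1
  ... | zero | suc zero | _ with B₀ , pB₀ , onlyAt ← #≡1⇒unique (λ B → p (true ∷ B)) #p₁ =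
    true ∷ B₀ , pB₀ , λ where
      (false ∷ B) pB → contradiction (trans (sym pB) (#≡0⇒none _ #p₀ B)) λ ()
      (true ∷ B)  pB → cong (true ∷_) (onlyAt B pB)
  ... | suc zero | zero | _ with B₀ , pB₀ , onlyAt ← #≡1⇒unique (λ B → p (false ∷ B)) #p₀ =
    false ∷ B₀ , pB₀ , λ where
      (false ∷ B) pB → cong (false ∷_) (onlyAt B pB)
      (true ∷ B)  pB → contradiction (trans (sym pB) (#≡0⇒none _ #p₁ B)) λ ()
  ... | zero        | zero        | ()
  ... | zero        | suc (suc _) | ()
  ... | suc zero    | suc _       | ()
  ... | suc (suc _) | _           | ()

  ∈-allSubsets : ∀ {n} (B : Vec Bool n) → B ∈ allSubsets n
  ∈-allSubsets []      = here refl
  ∈-allSubsets (b ∷ B) = ∈-concatMap⁺ _ (Any.map (λ { refl → ∷∈ b }) (∈-allSubsets B))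
    where
    ∷∈ : ∀ b → b ∷ B ∈ (false ∷ B) ∷ (true ∷ B) ∷ []
    ∷∈ false = here refl
    ∷∈ true  = there (here refl)

  listEq : List Bool → List Bool → Bool
  listEq []      []      = true
  listEq (a ∷ u) (b ∷ v) = boolEq a b ∧ listEq u v
  listEq _       _       = false

  ∑-select : ∀ n (t : Vec Bool n) (g : Vec Bool n → ℕ) →
    ∑ (allSubsets n) (λ τ → 𝟙 (listEq (toList t) (toList τ)) * g τ) ≡ g t
  ∑-select zero    []          g = trans (+-identityʳ _) (+-identityʳ (g []))
  ∑-select (suc n) (false ∷ t) g = trans (∑-allSubsets-∷ n _)
    (trans (cong₂ _+_ (∑-select n t (λ τ → g (false ∷ τ))) (∑-zero (allSubsets n) _ (λ _ → refl))) (+-identityʳ _))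
  ∑-select (suc n) (true ∷ t)  g = trans (∑-allSubsets-∷ n _)
    (cong₂ _+_ (∑-zero (allSubsets n) _ (λ _ → refl)) (∑-select n t (λ τ → g (true ∷ τ))))

module Bases where
  open Booleans
  open Counting

  -- Reading σ and a candidate set B from left to right, the slack is the rank of the prefix
  -- minus the number of elements of B in it: an isthmus (0 in σ) raises it, and every element
  -- of B uses one unit.  The result is nothing as soon as B overdraws it.
  grow : Bool → ℕ → ℕ
  grow false s = suc s
  grow true  s = s

  mutual
    slack : ∀ {n} → ℕ → Vec Bool n → Vec Bool n → Maybe ℕ
    slack s []      []          = just s
    slack s (y ∷ σ) (false ∷ B) = slack (grow y s) σ B
    slack s (y ∷ σ) (true ∷ B)  = slack∸1 (grow y s) σ B

    slack∸1 : ∀ {n} → ℕ → Vec Bool n → Vec Bool n → Maybe ℕ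
    slack∸1 zero    σ B = nothing
    slack∸1 (suc s) σ B = slack s σ B

  grow-mono-≤ : ∀ y {s s′} → s ≤ s′ → grow y s ≤ grow y s′
  grow-mono-≤ false s≤s′ = s≤s s≤s′
  grow-mono-≤ true  s≤s′ = s≤s′

  grow-mono-< : ∀ y {s s′} → s < s′ → grow y s < grow y s′
  grow-mono-< false s<s′ = s≤s s<s′
  grow-mono-< true  s<s′ = s<s′

  grow-suc : ∀ y s → grow y (suc s) ≡ suc (grow y s)
  grow-suc false s = refl
  grow-suc true  s = refl

  grow≤suc : ∀ y s → grow y s ≤ suc s
  grow≤suc false s = ≤-refl
  grow≤suc true  s = n≤1+n s

  grow-∸ : ∀ y {s} j → j ≤ s → grow y (s ∸ j) ≡ grow y s ∸ j
  grow-∸ false j j≤s = sym (+-∸-assoc 1 j≤s)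
  grow-∸ true  j j≤s = refl

  slack-∷ʳ : ∀ {n} s (σ B : Vec Bool n) a b →
    slack s (σ ∷ʳ a) (B ∷ʳ b) ≡ (slack s σ B >>= λ k → slack k (a ∷ []) (b ∷ []))
  slack-∷ʳ s []      []          a false = refl
  slack-∷ʳ s []      []          a true  with grow a s
  ... | zero  = refl
  ... | suc _ = refl
  slack-∷ʳ s (y ∷ σ) (false ∷ B) a b = slack-∷ʳ (grow y s) σ B a b
  slack-∷ʳ s (y ∷ σ) (true ∷ B)  a b with grow y s
  ... | zero  = refl
  ... | suc u = slack-∷ʳ u σ B a b

  slack+card : ∀ {n} s (σ B : Vec Bool n) k → slack s σ B ≡ just k → k + card B ≡ s + zeros σ
  slack+card s       []          []          k refl = refl
  slack+card s       (false ∷ σ) (false ∷ B) k e    = trans (slack+card (suc s) σ B k e) (sym (+-suc s (zeros σ)))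
  slack+card s       (true ∷ σ)  (false ∷ B) k e    = slack+card s σ B k e
  slack+card (suc s) (true ∷ σ)  (true ∷ B)  k e    = trans (+-suc k (card B)) (cong suc (slack+card s σ B k e))
  slack+card s       (false ∷ σ) (true ∷ B)  k e    =
    trans (+-suc k (card B)) (trans (cong suc (slack+card s σ B k e)) (sym (+-suc s (zeros σ))))

  slack-⊆ : ∀ {n} (σ S T : Vec Bool n) {s s′ k} → subsetᵇ S T ≡ true → slack s σ T ≡ just k → s ≤ s′ →
    ∃ λ k′ → slack s′ σ S ≡ just k′
  slack-⊆ []      []          []          S⊆T e s≤s′ = _ , refl
  slack-⊆ (y ∷ σ) (false ∷ S) (false ∷ T) S⊆T e s≤s′ = slack-⊆ σ S T S⊆T e (grow-mono-≤ y s≤s′)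
  slack-⊆ (y ∷ σ) (false ∷ S) (true ∷ T) {s} {s′} S⊆T e s≤s′ with grow y s in eq
  ... | suc u = slack-⊆ σ S T S⊆T e (≤-trans (n≤1+n u) (subst (_≤ grow y s′) eq (grow-mono-≤ y s≤s′)))
  slack-⊆ (y ∷ σ) (true ∷ S)  (true ∷ T) {s} {s′} S⊆T e s≤s′ with grow y s in eq | grow y s′ in eq′
  ... | suc u | zero   = contradiction (subst₂ _≤_ eq eq′ (grow-mono-≤ y s≤s′)) λ ()
  ... | suc u | suc u′ = slack-⊆ σ S T S⊆T e (s≤s⁻¹ (subst₂ _≤_ eq eq′ (grow-mono-≤ y s≤s′)))

  ⊆ᵇ-refl : ∀ {n} (S : Vec Bool n) → subsetᵇ S S ≡ true
  ⊆ᵇ-refl []          = refl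
  ⊆ᵇ-refl (true ∷ S)  = ⊆ᵇ-refl S
  ⊆ᵇ-refl (false ∷ S) = ⊆ᵇ-refl S

  ⊆ᵇ-∷ʳ : ∀ {n} (S T : Vec Bool n) a b → subsetᵇ (S ∷ʳ a) (T ∷ʳ b) ≡ subsetᵇ S T ∧ (not a ∨ b)
  ⊆ᵇ-∷ʳ []      []      a b = ∧-identityʳ _
  ⊆ᵇ-∷ʳ (x ∷ S) (y ∷ T) a b = trans (cong ((not x ∨ y) ∧_) (⊆ᵇ-∷ʳ S T a b)) (sym (∧-assoc (not x ∨ y) _ _))

  ⊆ᵇ-reverse : ∀ {n} (S T : Vec Bool n) → subsetᵇ (reverse S) (reverse T) ≡ subsetᵇ S T
  ⊆ᵇ-reverse []      []      = refl
  ⊆ᵇ-reverse (a ∷ S) (b ∷ T) = begin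
    subsetᵇ (reverse (a ∷ S)) (reverse (b ∷ T)) ≡⟨ cong₂ subsetᵇ (reverse-∷ a S) (reverse-∷ b T) ⟩
    subsetᵇ (reverse S ∷ʳ a) (reverse T ∷ʳ b)   ≡⟨ ⊆ᵇ-∷ʳ (reverse S) (reverse T) a b ⟩
    subsetᵇ (reverse S) (reverse T) ∧ (not a ∨ b) ≡⟨ cong (_∧ (not a ∨ b)) (⊆ᵇ-reverse S T) ⟩
    subsetᵇ S T ∧ (not a ∨ b)                   ≡⟨ ∧-comm (subsetᵇ S T) _ ⟩
    subsetᵇ (a ∷ S) (b ∷ T)                     ∎
    where open ≡-Reasoning

  card-∷ʳ : ∀ {n} (S : Vec Bool n) b → card (S ∷ʳ b) ≡ card S + card (b ∷ [])
  card-∷ʳ []          b = refl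
  card-∷ʳ (true ∷ S)  b = cong suc (card-∷ʳ S b)
  card-∷ʳ (false ∷ S) b = card-∷ʳ S b

  zeros-∷ʳ : ∀ {n} (S : Vec Bool n) b → zeros (S ∷ʳ b) ≡ zeros S + zeros (b ∷ [])
  zeros-∷ʳ []          b = refl
  zeros-∷ʳ (true ∷ S)  b = zeros-∷ʳ S b
  zeros-∷ʳ (false ∷ S) b = cong suc (zeros-∷ʳ S b)

  card-reverse : ∀ {n} (S : Vec Bool n) → card (reverse S) ≡ card S
  card-reverse []      = refl
  card-reverse (b ∷ S) = begin
    card (reverse (b ∷ S))         ≡⟨ cong card (reverse-∷ b S) ⟩
    card (reverse S ∷ʳ b)          ≡⟨ card-∷ʳ (reverse S) b ⟩
    card (reverse S) + card (b ∷ []) ≡⟨ cong (_+ card (b ∷ [])) (card-reverse S) ⟩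
    card S + card (b ∷ [])         ≡⟨ +-comm (card S) _ ⟩
    card (b ∷ []) + card S         ≡⟨ lemma b ⟩
    card (b ∷ S)                   ∎
    where
    open ≡-Reasoning
    lemma : ∀ b → card (b ∷ []) + card S ≡ card (b ∷ S)
    lemma true  = refl
    lemma false = refl

  zeros-reverse : ∀ {n} (S : Vec Bool n) → zeros (reverse S) ≡ zeros S
  zeros-reverse []      = refl
  zeros-reverse (b ∷ S) = begin
    zeros (reverse (b ∷ S))          ≡⟨ cong zeros (reverse-∷ b S) ⟩
    zeros (reverse S ∷ʳ b)           ≡⟨ zeros-∷ʳ (reverse S) b ⟩
    zeros (reverse S) + zeros (b ∷ []) ≡⟨ cong (_+ zeros (b ∷ [])) (zeros-reverse S) ⟩
    zeros S + zeros (b ∷ [])         ≡⟨ +-comm (zeros S) _ ⟩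
    zeros (b ∷ []) + zeros S         ≡⟨ lemma b ⟩
    zeros (b ∷ S)                    ∎
    where
    open ≡-Reasoning
    lemma : ∀ b → zeros (b ∷ []) + zeros S ≡ zeros (b ∷ S)
    lemma true  = refl
    lemma false = refl

  slack-reverse-∷ : ∀ {n} a b (ρ S : Vec Bool n) →
    slack 0 (reverse (a ∷ ρ)) (reverse (b ∷ S)) ≡ (slack 0 (reverse ρ) (reverse S) >>= λ k → slack k (a ∷ []) (b ∷ []))
  slack-reverse-∷ a b ρ S = trans (cong₂ (slack 0) (reverse-∷ a ρ) (reverse-∷ b S)) (slack-∷ʳ 0 (reverse ρ) (reverse S) a b)

  slack∸1-∸ : ∀ s {j} → suc j ≤ s → slack∸1 (s ∸ j) [] [] ≡ just (s ∸ suc j)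
  slack∸1-∸ (suc s) (s≤s j≤s) rewrite +-∸-assoc 1 j≤s = refl

  slack-augment : ∀ {n} (ρ S : Vec Bool n) {k} → slack 0 (reverse ρ) (reverse S) ≡ just k → ∀ j → j ≤ k →
    ∃ λ T → subsetᵇ S T ≡ true × slack 0 (reverse ρ) (reverse T) ≡ just (k ∸ j)
  slack-augment []      []      refl zero z≤n = [] , refl , refl
  slack-augment (a ∷ ρ) (b ∷ S) e j j≤k
    with slack 0 (reverse ρ) (reverse S) in e₀ | trans (sym (slack-reverse-∷ a b ρ S)) e
  slack-augment (a ∷ ρ) (true ∷ S) e j j≤k | just k₀ | e′ with grow a k₀ in eqa | e′
  ... | suc k′ | refl =
    let T₀ , S⊆T₀ , e₁ = slack-augment ρ S e₀ j j≤k₀ in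
    true ∷ T₀ , S⊆T₀ , trans (slack-reverse-∷ a true ρ T₀) (trans (cong (_>>= λ k → slack k (a ∷ []) (true ∷ [])) e₁) final)
    where
    j≤k₀ : j ≤ k₀
    j≤k₀ = ≤-trans j≤k (s≤s⁻¹ (subst (_≤ suc k₀) eqa (grow≤suc a k₀)))
    final : slack∸1 (grow a (k₀ ∸ j)) [] [] ≡ just (k′ ∸ j)
    final rewrite grow-∸ a j j≤k₀ | eqa | +-∸-assoc 1 j≤k = refl
  slack-augment (a ∷ ρ) (false ∷ S) e zero    j≤k | just k₀ | e′ = false ∷ S , ⊆ᵇ-refl S , e
  slack-augment (a ∷ ρ) (false ∷ S) e (suc j) j≤k | just k₀ | refl =
    let T₀ , S⊆T₀ , e₁ = slack-augment ρ S e₀ j j≤k₀ in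
    true ∷ T₀ , S⊆T₀ , trans (slack-reverse-∷ a true ρ T₀) (trans (cong (_>>= λ k → slack k (a ∷ []) (true ∷ [])) e₁) final)
    where
    j≤k₀ : j ≤ k₀
    j≤k₀ = s≤s⁻¹ (≤-trans j≤k (grow≤suc a k₀))
    final : slack∸1 (grow a (k₀ ∸ j)) [] [] ≡ just (grow a k₀ ∸ suc j)
    final rewrite grow-∸ a j j≤k₀ = slack∸1-∸ (grow a k₀) j≤k

  full⇒slack≡1 : ∀ {n} (ρ S : Vec Bool n) k → k + card S ≡ zeros ρ →
    indepRev ρ S ∧ (suc (card S) ≡ᵇ zeros ρ) ≡ true → k ≡ 1
  full⇒slack≡1 ρ S k size e = +-cancelʳ-≡ (card S) k 1 (trans size (sym (≡ᵇ⇒≡ _ _ (from T-≡ (proj₂ (∧-true⁻ e))))))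

  baseRev-∷⇔ : ∀ a b {n} (ρ S : Vec Bool n) (m : Maybe ℕ) →
    (∀ k → m ≡ just k → k + card S ≡ zeros ρ) →
    (baseRev ρ S ≡ true ⇔ m ≡ just 0) → (indepRev ρ S ≡ true ⇔ (∃ λ k → m ≡ just k)) →
    baseRev (a ∷ ρ) (b ∷ S) ≡ true ⇔ (m >>= λ k → slack k (a ∷ []) (b ∷ [])) ≡ just 0
  baseRev-∷⇔ false true  ρ S nothing  _ base _ = base
  baseRev-∷⇔ false true  ρ S (just k) _ base _ = base
  baseRev-∷⇔ true  false ρ S nothing  _ base _ = base
  baseRev-∷⇔ true  false ρ S (just k) _ base _ = base
  baseRev-∷⇔ false false ρ S nothing  _ _ _ = mk⇔ (λ ()) (λ ())
  baseRev-∷⇔ false false ρ S (just k) _ _ _ = mk⇔ (λ ()) (λ ())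
  baseRev-∷⇔ true  true  ρ S nothing  _ _ indep = mk⇔ (λ e → contradiction (proj₂ (to indep (proj₁ (∧-true⁻ e)))) λ ()) (λ ())
  baseRev-∷⇔ true  true  ρ S (just 0) size _ _ = mk⇔ (λ e → contradiction (full⇒slack≡1 ρ S 0 (size 0 refl) e) λ ()) (λ ())
  baseRev-∷⇔ true  true  ρ S (just 1) size _ indep =
    mk⇔ (λ _ → refl) (λ _ → ∧-true⁺ (from indep (1 , refl)) (to T-≡ (≡⇒≡ᵇ _ _ (size 1 refl))))
  baseRev-∷⇔ true  true  ρ S (just (suc (suc k))) size _ _ =
    mk⇔ (λ e → contradiction (full⇒slack≡1 ρ S _ (size _ refl) e) λ ()) (λ ())

  -- baseRev reads σ backwards, from the element added last, whereas the slack reads it forwards.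
  mutual
    baseRev⇔slack≡0 : ∀ {n} (ρ S : Vec Bool n) → baseRev ρ S ≡ true ⇔ slack 0 (reverse ρ) (reverse S) ≡ just 0
    baseRev⇔slack≡0 []      []      = mk⇔ (λ _ → refl) (λ _ → refl)
    baseRev⇔slack≡0 (a ∷ ρ) (b ∷ S) = subst (baseRev (a ∷ ρ) (b ∷ S) ≡ true ⇔_)
      (cong (_≡ just 0) (sym (slack-reverse-∷ a b ρ S)))
      (baseRev-∷⇔ a b ρ S _ size (baseRev⇔slack≡0 ρ S) (indepRev⇔slack≢nothing ρ S))
      where
      size : ∀ k → slack 0 (reverse ρ) (reverse S) ≡ just k → k + card S ≡ zeros ρ
      size k e = begin
        k + card S                  ≡⟨ cong (k +_) (card-reverse S) ⟨
        k + card (reverse S)        ≡⟨ slack+card 0 (reverse ρ) (reverse S) k e ⟩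
        zeros (reverse ρ)           ≡⟨ zeros-reverse ρ ⟩
        zeros ρ                     ∎
        where open ≡-Reasoning

    indepRev⇔slack≢nothing : ∀ {n} (ρ S : Vec Bool n) → indepRev ρ S ≡ true ⇔ (∃ λ k → slack 0 (reverse ρ) (reverse S) ≡ just k)
    indepRev⇔slack≢nothing {n} ρ S = mk⇔ fwd bwd
      where
      fwd : indepRev ρ S ≡ true → ∃ λ k → slack 0 (reverse ρ) (reverse S) ≡ just k
      fwd e with B , e′ ← any≡true⇒ _ (allSubsets _) e with base , S⊆B ← ∧-true⁻ e′ =
        slack-⊆ (reverse ρ) (reverse S) (reverse B) (trans (⊆ᵇ-reverse S B) S⊆B) (to (baseRev⇔slack≡0 ρ B) base) z≤n
      bwd : (∃ λ k → slack 0 (reverse ρ) (reverse S) ≡ just k) → indepRev ρ S ≡ true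
      bwd (k , e) with B , S⊆B , e′ ← slack-augment ρ S e k ≤-refl =
        any≡true⇐ _ (∈-allSubsets B) (∧-true⁺ (from (baseRev⇔slack≡0 ρ B) (trans e′ (cong just (n∸n≡0 k)))) S⊆B)

  isJust0 : Maybe ℕ → Bool
  isJust0 (just zero)    = true
  isJust0 (just (suc _)) = false
  isJust0 nothing        = false

  isJust0⇒≡ : ∀ m → isJust0 m ≡ true → m ≡ just 0
  isJust0⇒≡ (just zero) _ = refl

  zeroSlack : ∀ {n} → Vec Bool n → Vec Bool n → Bool
  zeroSlack σ B = isJust0 (slack 0 σ B)

  isBase≡zeroSlack : ∀ {n} (σ B : Vec Bool n) → isBase σ B ≡ zeroSlack σ B
  isBase≡zeroSlack σ B = bool-ext (mk⇔ (λ e → cong isJust0 (trans (sym reverse²) (to base e)))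
                                         (λ e → from base (trans reverse² (isJust0⇒≡ _ e))))
    where
    base = baseRev⇔slack≡0 (reverse σ) (reverse B)
    reverse² : slack 0 (reverse (reverse σ)) (reverse (reverse B)) ≡ slack 0 σ B
    reverse² = cong₂ (slack 0) (reverse-involutive σ) (reverse-involutive B)

  isBase⇒slack≡0 : ∀ {n} (σ B : Vec Bool n) → isBase σ B ≡ true → slack 0 σ B ≡ just 0
  isBase⇒slack≡0 σ B e = isJust0⇒≡ _ (trans (sym (isBase≡zeroSlack σ B)) e)

  slack≡0⇒isBase : ∀ {n} (σ B : Vec Bool n) → slack 0 σ B ≡ just 0 → isBase σ B ≡ true
  slack≡0⇒isBase σ B e = trans (isBase≡zeroSlack σ B) (cong isJust0 e)

module Exchange where
  open Booleans
  open Counting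
  open Bases

  -- The letter of an element records its bit in τ_B (0 = false for the elements of B) and the
  -- index of its block, blocks being closed whenever the slack returns to 0.
  Letter : Set
  Letter = Bool × ℕ

  exchangeable : Letter → Letter → Bool
  exchangeable (t , c) (t′ , c′) = not t ∧ (t′ ∧ (c ≤ᵇ c′))

  -- The slack after one element; pred truncates only where slack∸1 has already failed.
  step : ℕ → Bool → Bool → ℕ
  step s y false = grow y s
  step s y true  = pred (grow y s)

  nextBlock : ℕ → ℕ → ℕ
  nextBlock zero    c = suc c
  nextBlock (suc _) c = c

  c≤nextBlock : ∀ s c → c ≤ nextBlock s c
  c≤nextBlock zero    c = n≤1+n c
  c≤nextBlock (suc s) c = ≤-refl

  letters : ∀ {n} → ℕ → ℕ → Vec Bool n → Vec Bool n → List Letter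
  letters s c []      []      = []
  letters s c (y ∷ σ) (x ∷ B) = (not x , c) ∷ letters (step s y x) (nextBlock (step s y x) c) σ B

  word : ∀ {n} → ℕ → ℕ → Vec Bool n → Vec Bool n → Vec ℕ n → List (Letter × ℕ)
  word s c σ B f = zip (letters s c σ B) (toList f)

  respects : Letter × ℕ → Letter × ℕ → Bool
  respects (x , v) (y , u) = (not (exchangeable x y) ∨ (v <ᵇ u)) ∧ (not (exchangeable y x) ∨ (u <ᵇ v))

  localᵇ : ∀ {n} → Vec Bool n → Vec Bool n → Vec ℕ n → Bool
  localᵇ σ B f = pairwise respects (word 0 0 σ B f)

  StrictlyLightest : ∀ {n} → ℕ → Vec Bool n → Vec ℕ n → Vec Bool n → Set
  StrictlyLightest s σ f B = ∀ B′ → slack s σ B′ ≡ just 0 → B′ ≡ B ⊎ weight f B < weight f B′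

  slack∸1-grow-suc : ∀ {n} y t (σ Y : Vec Bool n) → slack∸1 (grow y (suc t)) σ Y ≡ slack (grow y t) σ Y
  slack∸1-grow-suc false t σ Y = refl
  slack∸1-grow-suc true  t σ Y = refl

  slack-grow-suc : ∀ {n} y t (σ Y : Vec Bool n) → slack (grow y (suc t)) σ Y ≡ slack (suc (grow y t)) σ Y
  slack-grow-suc false t σ Y = refl
  slack-grow-suc true  t σ Y = refl

  respects-laterBlock : ∀ {n} s c′ (σ B : Vec Bool n) (f : Vec ℕ n) c K → c < c′ →
    all (respects ((true , c) , K)) (word s c′ σ B f) ≡ true
  respects-laterBlock s c′ []      []      []      c K c<c′ = refl
  respects-laterBlock s c′ (y ∷ σ) (x ∷ B) (v ∷ f) c K c<c′
    rewrite >⇒≤ᵇ≡false c<c′ | ∧-zeroʳ (not (not x)) =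
    respects-laterBlock (step s y x) _ σ B f c K (<-≤-trans c<c′ (c≤nextBlock (step s y x) c′))

  -- If B′ avoids an element e of B, then B′ with some element exchanged for e is lighter.
  swapIn : ∀ {n} (σ X Y : Vec Bool n) (f : Vec ℕ n) t u c c₀ K →
    slack t σ X ≡ just 0 → slack (suc u) σ Y ≡ just 0 → t ≤ u → c₀ ≤ c →
    all (respects ((false , c₀) , K)) (word t c σ X f) ≡ true →
    ∃ λ Y′ → slack u σ Y′ ≡ just 0 × K + weight f Y′ < weight f Y
  swapIn [] [] [] [] t u c c₀ K eX () t≤u c₀≤c resp
  swapIn (y ∷ σ) (false ∷ X) (true ∷ Y) (v ∷ f) t u c c₀ K eX eY t≤u c₀≤c resp
    rewrite grow-suc y u | ≤⇒≤ᵇ≡true c₀≤c =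
    false ∷ Y , eY , +-monoˡ-< (weight f Y) (<ᵇ≡true⇒< (proj₁ (∧-true⁻ (proj₁ (∧-true⁻ resp)))))
  swapIn (y ∷ σ) (false ∷ X) (false ∷ Y) (v ∷ f) t u c c₀ K eX eY t≤u c₀≤c resp
    rewrite grow-suc y u
    with Y′ , eY′ , lighter ← swapIn σ X Y f (grow y t) (grow y u) _ c₀ K eX eY (grow-mono-≤ y t≤u)
                                (≤-trans c₀≤c (c≤nextBlock (grow y t) c)) (proj₂ (∧-true⁻ resp)) =
    false ∷ Y′ , eY′ , lighter
  swapIn (y ∷ σ) (true ∷ X) (true ∷ Y) (v ∷ f) t u c c₀ K eX eY t≤u c₀≤c resp
    rewrite grow-suc y u with grow y t in et | grow y u in eu
  ... | suc t′ | zero = contradiction (subst₂ _≤_ et eu (grow-mono-≤ y t≤u)) λ ()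
  ... | suc t′ | suc u′
    with Y′ , eY′ , lighter ← swapIn σ X Y f t′ u′ _ c₀ K eX eY (s≤s⁻¹ (subst₂ _≤_ et eu (grow-mono-≤ y t≤u)))
                                (≤-trans c₀≤c (c≤nextBlock t′ c)) (proj₂ (∧-true⁻ resp)) =
    true ∷ Y′ , subst (λ s → slack∸1 s σ Y′ ≡ just 0) (sym eu) eY′ ,
    subst (_< v + weight f Y) (x∙yz≈y∙xz v K _) (+-monoʳ-< v lighter)
  swapIn (y ∷ σ) (true ∷ X) (false ∷ Y) (v ∷ f) t u c c₀ K eX eY t≤u c₀≤c resp
    rewrite grow-suc y u with grow y t in et
  ... | suc t′
    with Y′ , eY′ , lighter ← swapIn σ X Y f t′ (grow y u) _ c₀ K eX eY
                                (≤-trans (n≤1+n t′) (subst (_≤ grow y u) et (grow-mono-≤ y t≤u)))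
                                (≤-trans c₀≤c (c≤nextBlock t′ c)) (proj₂ (∧-true⁻ resp)) =
    false ∷ Y′ , eY′ , lighter

  -- If B′ contains an element e outside B, then B′ with e exchanged for an element of B in the
  -- same block is lighter.
  swapOut : ∀ {n} (σ X Y : Vec Bool n) (f : Vec ℕ n) t u c K →
    slack u σ X ≡ just 0 → slack t σ Y ≡ just 0 → t < u →
    all (respects ((true , c) , K)) (word u c σ X f) ≡ true →
    ∃ λ Y′ → slack (suc t) σ Y′ ≡ just 0 × weight f Y′ < weight f Y + K
  swapOut [] [] [] [] t u c K refl refl () resp
  swapOut (y ∷ σ) (true ∷ X) (false ∷ Y) (v ∷ f) t u c K eX eY t<u resp
    rewrite ≤⇒≤ᵇ≡true (≤-refl {c}) =
    true ∷ Y , trans (slack∸1-grow-suc y t σ Y) eY ,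
    subst (v + weight f Y <_) (+-comm K (weight f Y)) (+-monoˡ-< (weight f Y) (<ᵇ≡true⇒< (proj₁ (∧-true⁻ resp))))
  swapOut (y ∷ σ) (false ∷ X) (false ∷ Y) (v ∷ f) t u c K eX eY t<u resp with grow y u in eu
  ... | zero = contradiction (subst (grow y t <_) eu (grow-mono-< y t<u)) λ ()
  ... | suc u′
    with Y′ , eY′ , lighter ← swapOut σ X Y f (grow y t) (suc u′) c K eX eY
                                (subst (grow y t <_) eu (grow-mono-< y t<u)) (proj₂ (∧-true⁻ resp)) =
    false ∷ Y′ , trans (slack-grow-suc y t σ Y′) eY′ , lighter
  swapOut (y ∷ σ) (true ∷ X) (true ∷ Y) (v ∷ f) t u c K eX eY t<u resp with grow y u in eu | grow y t in et
  ... | suc zero     | suc t′ = contradiction (s≤s⁻¹ (subst₂ _<_ et eu (grow-mono-< y t<u))) λ ()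
  ... | suc (suc u′) | suc t′
    with Y′ , eY′ , lighter ← swapOut σ X Y f t′ (suc u′) c K eX eY
                                (s≤s⁻¹ (subst₂ _<_ et eu (grow-mono-< y t<u))) (proj₂ (∧-true⁻ resp)) =
    true ∷ Y′ , trans (slack∸1-grow-suc y t σ Y′) (subst (λ s → slack s σ Y′ ≡ just 0) (sym et) eY′) ,
    subst (v + weight f Y′ <_) (sym (+-assoc v _ K)) (+-monoʳ-< v lighter)
  swapOut (y ∷ σ) (false ∷ X) (true ∷ Y) (v ∷ f) t u c K eX eY t<u resp with grow y u in eu | grow y t in et
  ... | zero   | suc t′ = contradiction (subst₂ _<_ et eu (grow-mono-< y t<u)) λ ()
  ... | suc u′ | suc t′
    with Y′ , eY′ , lighter ← swapOut σ X Y f t′ (suc u′) c K eX eY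
                                (<-trans (n<1+n t′) (subst₂ _<_ et eu (grow-mono-< y t<u))) (proj₂ (∧-true⁻ resp)) =
    true ∷ Y′ , trans (slack∸1-grow-suc y t σ Y′) (subst (λ s → slack s σ Y′ ≡ just 0) (sym et) eY′) ,
    subst (v + weight f Y′ <_) (sym (+-assoc v _ K)) (+-monoʳ-< v lighter)

  ≡⊎<⇒≤ : ∀ {n} (f : Vec ℕ n) B B′ → B′ ≡ B ⊎ weight f B < weight f B′ → weight f B ≤ weight f B′
  ≡⊎<⇒≤ f B .B (inj₁ refl) = ≤-refl
  ≡⊎<⇒≤ f B B′ (inj₂ B<B′) = <⇒≤ B<B′

  local⇒strictlyLightest : ∀ {n} (σ B : Vec Bool n) (f : Vec ℕ n) s c → slack s σ B ≡ just 0 →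
    pairwise respects (word s c σ B f) ≡ true → StrictlyLightest s σ f B
  local⇒strictlyLightest [] [] [] s c eB loc [] eB′ = inj₁ refl
  local⇒strictlyLightest (y ∷ σ) (false ∷ X) (v ∷ f) s c eX loc (false ∷ X′) eX′
    with local⇒strictlyLightest σ X f (grow y s) _ eX (proj₂ (∧-true⁻ loc)) X′ eX′
  ... | inj₁ refl = inj₁ refl
  ... | inj₂ X<X′ = inj₂ X<X′
  local⇒strictlyLightest (y ∷ σ) (true ∷ X) (v ∷ f) s c eX loc (true ∷ X′) eX′ with grow y s
  ... | suc s′ with local⇒strictlyLightest σ X f s′ _ eX (proj₂ (∧-true⁻ loc)) X′ eX′
  ...   | inj₁ refl = inj₁ refl
  ...   | inj₂ X<X′ = inj₂ (+-monoʳ-< v X<X′)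
  local⇒strictlyLightest (y ∷ σ) (true ∷ X) (v ∷ f) s c eX loc (false ∷ X′) eX′ with grow y s
  ... | suc s′
    with Y′ , eY′ , lighter ← swapIn σ X X′ f s′ s′ _ c v eX eX′ ≤-refl (c≤nextBlock s′ c) (proj₁ (∧-true⁻ loc)) =
    inj₂ (≤-<-trans (+-monoʳ-≤ v (≡⊎<⇒≤ f X Y′ (local⇒strictlyLightest σ X f s′ _ eX (proj₂ (∧-true⁻ loc)) Y′ eY′))) lighter)
  local⇒strictlyLightest (y ∷ σ) (false ∷ X) (v ∷ f) s c eX loc (true ∷ X′) eX′ with grow y s
  ... | suc s′
    with Y′ , eY′ , lighter ← swapOut σ X X′ f s′ (suc s′) c v eX eX′ ≤-refl (proj₁ (∧-true⁻ loc)) =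
    inj₂ (≤-<-trans (≡⊎<⇒≤ f X Y′ (local⇒strictlyLightest σ X f (suc s′) c eX (proj₂ (∧-true⁻ loc)) Y′ eY′))
                    (subst (weight f Y′ <_) (+-comm (weight f X′) v) lighter))

  lighter⇒respects-in : ∀ {n} (σ X : Vec Bool n) (f : Vec ℕ n) t c c₀ K → slack t σ X ≡ just 0 →
    (∀ Y → slack (suc t) σ Y ≡ just 0 → K + weight f X < weight f Y) →
    all (respects ((false , c₀) , K)) (word t c σ X f) ≡ true
  lighter⇒respects-in [] [] [] t c c₀ K eX lighter = refl
  lighter⇒respects-in (y ∷ σ) (false ∷ X) (v ∷ f) t c c₀ K eX lighter
    rewrite <⇒<ᵇ≡true (+-cancelʳ-< (weight f X) K v (lighter (true ∷ X) (trans (slack∸1-grow-suc y t σ X) eX)))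
          | ∨-zeroʳ (not (c₀ ≤ᵇ c)) =
    lighter⇒respects-in σ X f (grow y t) _ c₀ K eX (λ Y eY → lighter (false ∷ Y) (trans (slack-grow-suc y t σ Y) eY))
  lighter⇒respects-in (y ∷ σ) (true ∷ X) (v ∷ f) t c c₀ K eX lighter with grow y t in et
  ... | suc t′ = lighter⇒respects-in σ X f t′ _ c₀ K eX lighter′
    where
    lighter′ : ∀ Y → slack (suc t′) σ Y ≡ just 0 → K + weight f X < weight f Y
    lighter′ Y eY = +-cancelˡ-< v _ _ (subst (_< v + weight f Y) (x∙yz≈y∙xz K v _)
      (lighter (true ∷ Y) (trans (slack∸1-grow-suc y t σ Y) (subst (λ s → slack s σ Y ≡ just 0) (sym et) eY))))

  lighter⇒respects-out : ∀ {n} (σ X : Vec Bool n) (f : Vec ℕ n) u c K → slack (suc u) σ X ≡ just 0 →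
    (∀ Y → slack u σ Y ≡ just 0 → weight f X < K + weight f Y) →
    all (respects ((true , c) , K)) (word (suc u) c σ X f) ≡ true
  lighter⇒respects-out [] [] [] u c K eX lighter = refl
  lighter⇒respects-out (y ∷ σ) (false ∷ X) (v ∷ f) u c K eX lighter rewrite grow-suc y u =
    lighter⇒respects-out σ X f (grow y u) c K eX (λ Y eY → lighter (false ∷ Y) eY)
  lighter⇒respects-out (y ∷ σ) (true ∷ X) (v ∷ f) u c K eX lighter
    rewrite ≤⇒≤ᵇ≡true (≤-refl {c})
          | <⇒<ᵇ≡true (+-cancelʳ-< (weight f X) v K (lighter (false ∷ X) (trans (sym (slack∸1-grow-suc y u σ X)) eX)))
          | grow-suc y u with grow y u in eu
  ... | zero    = respects-laterBlock 0 (suc c) σ X f c K (n<1+n c)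
  ... | suc u′ = lighter⇒respects-out σ X f u′ c K eX lighter′
    where
    lighter′ : ∀ Y → slack u′ σ Y ≡ just 0 → weight f X < K + weight f Y
    lighter′ Y eY = +-cancelˡ-< v _ _ (subst (v + weight f X <_) (x∙yz≈y∙xz K v _)
      (lighter (true ∷ Y) (subst (λ s → slack∸1 s σ Y ≡ just 0) (sym eu) eY)))

  strictlyLightest⇒local : ∀ {n} (σ B : Vec Bool n) (f : Vec ℕ n) s c → slack s σ B ≡ just 0 →
    StrictlyLightest s σ f B → pairwise respects (word s c σ B f) ≡ true
  strictlyLightest⇒local [] [] [] s c eB lightest = refl
  strictlyLightest⇒local (y ∷ σ) (false ∷ X) (v ∷ f) s c eX lightest =
    ∧-true⁺ headRespects (strictlyLightest⇒local σ X f (grow y s) _ eX lightest′)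
    where
    lightest′ : StrictlyLightest (grow y s) σ f X
    lightest′ X′ eX′ with lightest (false ∷ X′) eX′
    ... | inj₁ X′≡X   = inj₁ (∷-injectiveʳ X′≡X)
    ... | inj₂ X<X′ = inj₂ X<X′
    headRespects : all (respects ((true , c) , v)) (word (grow y s) (nextBlock (grow y s) c) σ X f) ≡ true
    headRespects with grow y s in es
    ... | zero    = respects-laterBlock 0 (suc c) σ X f c v (n<1+n c)
    ... | suc s′ = lighter⇒respects-out σ X f s′ c v eX lighter
      where
      lighter : ∀ Y → slack s′ σ Y ≡ just 0 → weight f X < v + weight f Y
      lighter Y eY with lightest (true ∷ Y) (subst (λ s → slack∸1 s σ Y ≡ just 0) (sym es) eY)
      ... | inj₂ X<Y = X<Y
  strictlyLightest⇒local (y ∷ σ) (true ∷ X) (v ∷ f) s c eX lightest with grow y s in es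
  ... | suc t = ∧-true⁺ (lighter⇒respects-in σ X f t _ c v eX lighter) (strictlyLightest⇒local σ X f t _ eX lightest′)
    where
    lighter : ∀ Y → slack (suc t) σ Y ≡ just 0 → v + weight f X < weight f Y
    lighter Y eY with lightest (false ∷ Y) (subst (λ s → slack s σ Y ≡ just 0) (sym es) eY)
    ... | inj₂ X<Y = X<Y
    lightest′ : StrictlyLightest t σ f X
    lightest′ X′ eX′ with lightest (true ∷ X′) (subst (λ s → slack∸1 s σ X′ ≡ just 0) (sym es) eX′)
    ... | inj₁ X′≡X   = inj₁ (∷-injectiveʳ X′≡X)
    ... | inj₂ X<X′ = inj₂ (+-cancelˡ-< v _ _ X<X′)

  module _ {n} (σ : Vec Bool n) (f : Vec ℕ n) where

    isMinBase : Vec Bool n → Bool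
    isMinBase B = isBase σ B ∧ all (λ B′ → not (isBase σ B′) ∨ (weight f B ≤ᵇ weight f B′)) (allSubsets n)

    isLocalBase : Vec Bool n → Bool
    isLocalBase B = zeroSlack σ B ∧ localᵇ σ B f

    isMinBase⇒≤ : ∀ {B B′} → isMinBase B ≡ true → isBase σ B′ ≡ true → weight f B ≤ weight f B′
    isMinBase⇒≤ {B} {B′} min base′ = ≤ᵇ≡true⇒≤ (subst (λ b → (not b ∨ (weight f B ≤ᵇ weight f B′)) ≡ true) base′
      (all≡true⇒ (λ B′ → not (isBase σ B′) ∨ (weight f B ≤ᵇ weight f B′)) (∈-allSubsets B′) (proj₂ (∧-true⁻ min))))

    ≤⇒isMinBase : ∀ {B} → isBase σ B ≡ true → (∀ B′ → isBase σ B′ ≡ true → weight f B ≤ weight f B′) → isMinBase B ≡ true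
    ≤⇒isMinBase {B} base lightest = ∧-true⁺ base (all≡true⇐ _ (allSubsets n) noLighter)
      where
      noLighter : ∀ B′ → (not (isBase σ B′) ∨ (weight f B ≤ᵇ weight f B′)) ≡ true
      noLighter B′ with isBase σ B′ in base′
      ... | false = refl
      ... | true  = ≤⇒≤ᵇ≡true (lightest B′ base′)

    localBase⇒strictlyLightest : ∀ {B} → isLocalBase B ≡ true → ∀ B′ → isBase σ B′ ≡ true →
      B′ ≡ B ⊎ weight f B < weight f B′
    localBase⇒strictlyLightest {B} localBase B′ base′ = local⇒strictlyLightest σ B f 0 0
      (isJust0⇒≡ _ (proj₁ (∧-true⁻ localBase))) (proj₂ (∧-true⁻ localBase)) B′ (isBase⇒slack≡0 σ B′ base′)

    localBase⇒#≡1 : ∀ {B₀} → isLocalBase B₀ ≡ true → # isLocalBase ≡ 1 × # isMinBase ≡ 1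
    localBase⇒#≡1 {B₀} localBase₀ = #≡1 isLocalBase B₀ localBase₀ onlyLocal , #≡1 isMinBase B₀ min₀ onlyMin
      where
      base₀ : isBase σ B₀ ≡ true
      base₀ = trans (isBase≡zeroSlack σ B₀) (proj₁ (∧-true⁻ localBase₀))
      min₀ : isMinBase B₀ ≡ true
      min₀ = ≤⇒isMinBase base₀ (λ B′ base′ → ≡⊎<⇒≤ f B₀ B′ (localBase⇒strictlyLightest localBase₀ B′ base′))
      onlyMin : ∀ B → isMinBase B ≡ true → B ≡ B₀
      onlyMin B min with localBase⇒strictlyLightest localBase₀ B (proj₁ (∧-true⁻ min))
      ... | inj₁ B≡B₀ = B≡B₀
      ... | inj₂ B₀<B = contradiction (isMinBase⇒≤ min base₀) (<⇒≱ B₀<B)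
      onlyLocal : ∀ B → isLocalBase B ≡ true → B ≡ B₀
      onlyLocal B localBase with localBase⇒strictlyLightest localBase₀ B (trans (isBase≡zeroSlack σ B) (proj₁ (∧-true⁻ localBase)))
      ... | inj₁ B≡B₀ = B≡B₀
      ... | inj₂ B₀<B with localBase⇒strictlyLightest localBase B₀ base₀
      ...   | inj₁ B₀≡B = sym B₀≡B
      ...   | inj₂ B<B₀ = contradiction B<B₀ (<-asym B₀<B)

    uniqueMinBase⇒local : ∀ {B₀} → isMinBase B₀ ≡ true → (∀ B → isMinBase B ≡ true → B ≡ B₀) → isLocalBase B₀ ≡ true
    uniqueMinBase⇒local {B₀} min₀ onlyMin = ∧-true⁺ (cong isJust0 slack₀)
      (strictlyLightest⇒local σ B₀ f 0 0 slack₀ lightest)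
      where
      base₀ = proj₁ (∧-true⁻ min₀)
      slack₀ = isBase⇒slack≡0 σ B₀ base₀
      lightest : StrictlyLightest 0 σ f B₀
      lightest B′ e′ with m≤n⇒m<n∨m≡n (isMinBase⇒≤ min₀ (slack≡0⇒isBase σ B′ e′))
      ... | inj₁ B₀<B′ = inj₂ B₀<B′
      ... | inj₂ B₀≡B′ = inj₁ (onlyMin B′ (≤⇒isMinBase (slack≡0⇒isBase σ B′ e′)
                                  (λ B″ base″ → subst (_≤ weight f B″) B₀≡B′ (isMinBase⇒≤ min₀ base″))))

  𝟙-generic : ∀ {n} (σ : Vec Bool n) f → 𝟙 (genericᵇ σ f) ≡ # (isLocalBase σ f)
  𝟙-generic {n} σ f rewrite length-filterᵇ (isMinBase σ f) (allSubsets n) with # (isLocalBase σ f) ≟ 0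
  ... | yes #local≡0 = trans (𝟙-≡ᵇ1 _ noUniqueMin) (sym #local≡0)
    where
    noUniqueMin : # (isMinBase σ f) ≢ 1
    noUniqueMin #min≡1 with B₀ , min₀ , onlyMin ← #≡1⇒unique _ #min≡1 =
      contradiction (trans (sym (uniqueMinBase⇒local σ f {B₀} min₀ onlyMin)) (#≡0⇒none _ #local≡0 B₀)) λ ()
  ... | no #local≢0 with B₀ , localBase₀ ← #≢0⇒witness _ #local≢0 with #local≡1 , #min≡1 ← localBase⇒#≡1 σ f {B₀} localBase₀
    rewrite #min≡1 = sym #local≡1

module Labellings where
  open Booleans
  open Counting

  ↭-Invariant : {A : Set} → (List A → Bool) → Set
  ↭-Invariant Φ = ∀ {xs ys} → xs ↭ ys → Φ xs ≡ Φ ys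

  values : ℕ → List ℕ
  values k = List.map suc (upTo k)

  module _ {A : Set} where

    all-↭ : ∀ (q : A → Bool) → ↭-Invariant (all q)
    all-↭ q xs↭ys = foldr-commMonoid (setoid Bool) ∧-isCommutativeMonoid (↭⇒↭ₛ (map⁺ q xs↭ys))

    #labellings : ℕ → List A → (List (A × ℕ) → Bool) → ℕ
    #labellings k []      Φ = 𝟙 (Φ [])
    #labellings k (a ∷ w) Φ = ∑ (values k) (λ v → #labellings k w (λ zs → Φ ((a , v) ∷ zs)))

    ∑-allMaps-zip : ∀ k n (w : List A) → List.length w ≡ n → (Φ : List (A × ℕ) → Bool) →
      ∑ (allMaps n k) (λ f → 𝟙 (Φ (zip w (toList f)))) ≡ #labellings k w Φ
    ∑-allMaps-zip k zero    []      refl Φ = +-identityʳ _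
    ∑-allMaps-zip k (suc n) (a ∷ w) |w| Φ = begin
      ∑ (allMaps (suc n) k) (λ f → 𝟙 (Φ (zip (a ∷ w) (toList f))))
        ≡⟨ ∑-concatMap (λ f → List.map (_∷ f) (values k)) (allMaps n k) _ ⟩
      ∑ (allMaps n k) (λ f → ∑ (List.map (_∷ f) (values k)) (λ f → 𝟙 (Φ (zip (a ∷ w) (toList f)))))
        ≡⟨ ∑-cong (allMaps n k) (λ f → ∑-map (_∷ f) (values k) _) ⟩
      ∑ (allMaps n k) (λ f → ∑ (values k) (λ v → 𝟙 (Φ ((a , v) ∷ zip w (toList f)))))
        ≡⟨ ∑-comm (allMaps n k) (values k) _ ⟩
      ∑ (values k) (λ v → ∑ (allMaps n k) (λ f → 𝟙 (Φ ((a , v) ∷ zip w (toList f)))))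
        ≡⟨ ∑-cong (values k) (λ v → ∑-allMaps-zip k n w (cong pred |w|) (λ zs → Φ ((a , v) ∷ zs))) ⟩
      #labellings k (a ∷ w) Φ ∎
      where open ≡-Reasoning

    #labellings-cong : ∀ k w {Φ Ψ : List (A × ℕ) → Bool} → (∀ zs → Φ zs ≡ Ψ zs) → #labellings k w Φ ≡ #labellings k w Ψ
    #labellings-cong k []      Φ≗Ψ = cong 𝟙 (Φ≗Ψ [])
    #labellings-cong k (a ∷ w) Φ≗Ψ = ∑-cong (values k) (λ v → #labellings-cong k w (λ zs → Φ≗Ψ ((a , v) ∷ zs)))

    #labellings-↭ : ∀ k {w w′ : List A} → w ↭ w′ → (Φ : List (A × ℕ) → Bool) → ↭-Invariant Φ →
      #labellings k w Φ ≡ #labellings k w′ Φ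
    #labellings-↭ k ↭.refl          Φ inv = refl
    #labellings-↭ k (↭.prep a w↭w′) Φ inv =
      ∑-cong (values k) (λ v → #labellings-↭ k w↭w′ (λ zs → Φ ((a , v) ∷ zs)) (λ p → inv (↭.prep (a , v) p)))
    #labellings-↭ k {a ∷ b ∷ w} {.b ∷ .a ∷ w′} (↭.swap .a .b w↭w′) Φ inv = trans
      (∑-cong (values k) (λ v → ∑-cong (values k) (λ u → trans
        (#labellings-↭ k w↭w′ (λ zs → Φ ((a , v) ∷ (b , u) ∷ zs)) (λ p → inv (↭.prep _ (↭.prep _ p))))
        (#labellings-cong k w′ (λ zs → inv (↭.swap (a , v) (b , u) ↭.refl))))))
      (∑-comm (values k) (values k) _)
    #labellings-↭ k (↭.trans w↭w″ w″↭w′) Φ inv = trans (#labellings-↭ k w↭w″ Φ inv) (#labellings-↭ k w″↭w′ Φ inv)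

    pairwise-↭ : ∀ (R : A → A → Bool) → (∀ x y → R x y ≡ R y x) → ↭-Invariant (pairwise R)
    pairwise-↭ R R-sym ↭.refl            = refl
    pairwise-↭ R R-sym (↭.prep x xs↭ys)  = cong₂ _∧_ (all-↭ (R x) xs↭ys) (pairwise-↭ R R-sym xs↭ys)
    pairwise-↭ R R-sym {a ∷ b ∷ xs} {.b ∷ .a ∷ ys} (↭.swap .a .b xs↭ys)
      rewrite all-↭ (R a) xs↭ys | all-↭ (R b) xs↭ys | pairwise-↭ R R-sym xs↭ys | R-sym a b =
      ∧-interchange (R b a) (all (R a) ys) (all (R b) ys) (pairwise R ys)
    pairwise-↭ R R-sym (↭.trans xs↭zs zs↭ys) = trans (pairwise-↭ R R-sym xs↭zs) (pairwise-↭ R R-sym zs↭ys)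

    multiplicity : ℕ → List (A × ℕ) → ℕ
    multiplicity i zs = sum (List.map (λ z → 𝟙 (proj₂ z ≡ᵇ i)) zs)

    hasContentᴸ : ℕ → List ℕ → List (A × ℕ) → Bool
    hasContentᴸ i []      zs = true
    hasContentᴸ i (a ∷ α) zs = (multiplicity i zs ≡ᵇ a) ∧ hasContentᴸ (suc i) α zs

    hasContentᴸ-↭ : ∀ i α → ↭-Invariant (hasContentᴸ i α)
    hasContentᴸ-↭ i []      zs↭zs′ = refl
    hasContentᴸ-↭ i (a ∷ α) zs↭zs′ = cong₂ _∧_ (cong (_≡ᵇ a) (sum-↭ (map⁺ _ zs↭zs′))) (hasContentᴸ-↭ (suc i) α zs↭zs′)

    countVal-zip : ∀ {n} i (w : List A) (f : Vec ℕ n) → List.length w ≡ n →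
      countVal i f ≡ multiplicity i (zip w (toList f))
    countVal-zip i []      []      _   = refl
    countVal-zip i (a ∷ w) (x ∷ f) |w| with x ≡ᵇ i
    ... | true  = cong suc (countVal-zip i w f (cong pred |w|))
    ... | false = countVal-zip i w f (cong pred |w|)

    contentAux-zip : ∀ {n} i α (w : List A) (f : Vec ℕ n) → List.length w ≡ n →
      contentAux i α f ≡ hasContentᴸ i α (zip w (toList f))
    contentAux-zip i []      w f |w| = refl
    contentAux-zip i (a ∷ α) w f |w| =
      cong₂ _∧_ (cong (_≡ᵇ a) (countVal-zip i w f |w|)) (contentAux-zip (suc i) α w f |w|)

module Partitions where
  open Booleans

  Increasing : ∀ {n} → Vec Bool n → Vec ℕ n → Set
  Increasing {n} τ f = ∀ (i j : Fin n) → rltᵇ τ i j ≡ true → lookup f i < lookup f j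

  ascends : Bool × ℕ → Bool × ℕ → Bool
  ascends (t , v) (t′ , u) = not (not t ∧ t′) ∨ (v <ᵇ u)

  all-zip⇒ : ∀ {n} (p : Bool × ℕ → Bool) (τ : Vec Bool n) (f : Vec ℕ n) → all p (zip (toList τ) (toList f)) ≡ true →
    ∀ j → p (lookup τ j , lookup f j) ≡ true
  all-zip⇒ p (t ∷ τ) (v ∷ f) allp zero    = proj₁ (∧-true⁻ allp)
  all-zip⇒ p (t ∷ τ) (v ∷ f) allp (suc j) = all-zip⇒ p τ f (proj₂ (∧-true⁻ allp)) j

  all-zip⇐ : ∀ {n} (p : Bool × ℕ → Bool) (τ : Vec Bool n) (f : Vec ℕ n) → (∀ j → p (lookup τ j , lookup f j) ≡ true) →
    all p (zip (toList τ) (toList f)) ≡ true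
  all-zip⇐ p []      []      allp = refl
  all-zip⇐ p (t ∷ τ) (v ∷ f) allp = ∧-true⁺ (allp zero) (all-zip⇐ p τ f (λ j → allp (suc j)))

  rlt⇒< : ∀ {n} (τ : Vec Bool n) i j → rltᵇ τ i j ≡ true → toℕ i < toℕ j
  rlt⇒< τ i j i<j = <ᵇ≡true⇒< (proj₂ (∧-true⁻ {lookup τ j} (proj₂ (∧-true⁻ {not (lookup τ i)} i<j))))

  ascending⇒increasing : ∀ {n} (τ : Vec Bool n) (f : Vec ℕ n) → pairwise ascends (zip (toList τ) (toList f)) ≡ true →
    Increasing τ f
  ascending⇒increasing (t ∷ τ) (v ∷ f) asc zero    zero    i<j = contradiction (rlt⇒< (t ∷ τ) zero zero i<j) λ ()
  ascending⇒increasing (t ∷ τ) (v ∷ f) asc (suc i) zero    i<j = contradiction (rlt⇒< (t ∷ τ) (suc i) zero i<j) λ ()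
  ascending⇒increasing (t ∷ τ) (v ∷ f) asc zero    (suc j) i<j
    with t | lookup τ j | all-zip⇒ (ascends (t , v)) τ f (proj₁ (∧-true⁻ asc)) j
  ... | false | true | v<u = <ᵇ≡true⇒< v<u
  ascending⇒increasing (t ∷ τ) (v ∷ f) asc (suc i) (suc j) i<j = ascending⇒increasing τ f (proj₂ (∧-true⁻ asc)) i j i<j

  ascends-head : ∀ {n} t v (τ : Vec Bool n) (f : Vec ℕ n) →
    (∀ j → not t ∧ (lookup τ j ∧ true) ≡ true → v < lookup f j) → ∀ j → ascends (t , v) (lookup τ j , lookup f j) ≡ true
  ascends-head true  v τ f _     j = refl
  ascends-head false v τ f below j with lookup τ j in τj
  ... | false = refl
  ... | true  = <⇒<ᵇ≡true (below j (cong (_∧ true) τj))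

  increasing⇒ascending : ∀ {n} (τ : Vec Bool n) (f : Vec ℕ n) → Increasing τ f →
    pairwise ascends (zip (toList τ) (toList f)) ≡ true
  increasing⇒ascending []      []      incr = refl
  increasing⇒ascending (t ∷ τ) (v ∷ f) incr = ∧-true⁺
    (all-zip⇐ (ascends (t , v)) τ f (ascends-head t v τ f (λ j → incr zero (suc j))))
    (increasing⇒ascending τ f (λ i j → incr (suc i) (suc j)))

  -- Since a strict labelling reverses every relation of R_τ, the (R_τ, γ)-partitions are the maps
  -- that strictly increase along R_τ.
  partition⇔increasing : ∀ {n} (τ : Vec Bool n) γ (f : Vec ℕ n) → StrictLabelling τ γ →
    partitionᵇ τ γ f ≡ true ⇔ Increasing τ f
  partition⇔increasing {n} τ γ f (_ , strict) = mk⇔ fwd bwd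
    where
    entry : Fin n → Fin n → Bool
    entry i j = not (rleᵇ τ i j) ∨ ((lookup f i ≤ᵇ lookup f j) ∧ (not (toℕ (γ j) <ᵇ toℕ (γ i)) ∨ (lookup f i <ᵇ lookup f j)))
    fwd : partitionᵇ τ γ f ≡ true → Increasing τ f
    fwd part i j i<j with all≡true⇒ (entry i) (∈-allFin j) (all≡true⇒ (λ i → all (entry i) (allFin n)) (∈-allFin i) part)
    ... | entryij rewrite i<j | ∨-zeroʳ (toℕ i ≡ᵇ toℕ j) | <⇒<ᵇ≡true (strict i j (from T-≡ i<j)) =
      <ᵇ≡true⇒< (proj₂ (∧-true⁻ entryij))
    bwd : Increasing τ f → partitionᵇ τ γ f ≡ true
    bwd incr = all≡true⇐ _ (allFin n) (λ i → all≡true⇐ _ (allFin n) (entry≡true i))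
      where
      entry≡true : ∀ i j → entry i j ≡ true
      entry≡true i j with rltᵇ τ i j in i<j
      ... | true rewrite ∨-zeroʳ (toℕ i ≡ᵇ toℕ j) | <⇒<ᵇ≡true (incr i j i<j) | ≤⇒≤ᵇ≡true (<⇒≤ (incr i j i<j))
                       | ∨-zeroʳ (not (toℕ (γ j) <ᵇ toℕ (γ i))) = refl
      ... | false with toℕ i ≡ᵇ toℕ j in i≡j
      ...   | false = refl
      ...   | true with refl ← toℕ-injective (≡ᵇ⇒≡ (toℕ i) (toℕ j) (from T-≡ i≡j))
                   rewrite ≤⇒≤ᵇ≡true (≤-refl {lookup f i}) | ¬-not (<-irrefl refl ∘ <ᵇ≡true⇒< {toℕ (γ i)}) = refl

  partition≡ascending : ∀ {n} (τ : Vec Bool n) γ (f : Vec ℕ n) → StrictLabelling τ γ →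
    partitionᵇ τ γ f ≡ pairwise ascends (zip (toList τ) (toList f))
  partition≡ascending τ γ f strict = bool-ext (⇔-trans (partition⇔increasing τ γ f strict)
    (mk⇔ (increasing⇒ascending τ f) (ascending⇒increasing τ f)))

module Sorting where
  open Booleans
  open Partitions
  open Counting
  open Bases
  open Exchange
  open Labellings

  block : ℕ → ℕ → ℕ → List Letter → List Letter
  block c b m R = replicate b (false , c) ++ replicate m (true , c) ++ R

  -- Within each block the letters of B are moved in front of the others; b and m count the
  -- letters of B and of its complement met so far in the current block.
  mutual
    sortedLetters : ∀ {n} → ℕ → ℕ → ℕ → ℕ → Vec Bool n → Vec Bool n → List Letter
    sortedLetters s c b m []      []      = block c b m []
    sortedLetters s c b m (y ∷ σ) (x ∷ B) = sortedLetters-close (step s y x) c (b + 𝟙 x) (m + 𝟙 (not x)) σ B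

    sortedLetters-close : ∀ {n} → ℕ → ℕ → ℕ → ℕ → Vec Bool n → Vec Bool n → List Letter
    sortedLetters-close zero    c b m σ B = block c b m (sortedLetters 0 (suc c) 0 0 σ B)
    sortedLetters-close (suc s) c b m σ B = sortedLetters (suc s) c b m σ B

  replicate-+1-++ : ∀ {A : Set} k (a : A) xs → replicate (k + 1) a ++ xs ≡ replicate k a ++ a ∷ xs
  replicate-+1-++ zero    a xs = refl
  replicate-+1-++ (suc k) a xs = cong (a ∷_) (replicate-+1-++ k a xs)

  block-insert : ∀ c b m x R → block c b m ((not x , c) ∷ R) ↭ block c (b + 𝟙 x) (m + 𝟙 (not x)) R
  block-insert c b m true R rewrite +-identityʳ m | replicate-+1-++ b (false , c) (replicate m (true , c) ++ R) =
    ++⁺ˡ (replicate b (false , c)) (shift (false , c) (replicate m (true , c)) R)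
  block-insert c b m false R rewrite +-identityʳ b | replicate-+1-++ m (true , c) R = ↭.refl

  mutual
    letters↭sorted : ∀ {n} s c b m (σ B : Vec Bool n) → block c b m (letters s c σ B) ↭ sortedLetters s c b m σ B
    letters↭sorted s c b m []      []      = ↭.refl
    letters↭sorted s c b m (y ∷ σ) (x ∷ B) =
      ↭.trans (block-insert c b m x _) (letters↭sorted-close (step s y x) c (b + 𝟙 x) (m + 𝟙 (not x)) σ B)

    letters↭sorted-close : ∀ {n} s c b m (σ B : Vec Bool n) →
      block c b m (letters s (nextBlock s c) σ B) ↭ sortedLetters-close s c b m σ B
    letters↭sorted-close zero    c b m σ B =
      ++⁺ˡ (replicate b (false , c)) (++⁺ˡ (replicate m (true , c)) (letters↭sorted 0 (suc c) 0 0 σ B))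
    letters↭sorted-close (suc s) c b m σ B = letters↭sorted (suc s) c b m σ B

  all-block⁺ : ∀ (p : Letter → Bool) c b m {R} → p (false , c) ≡ true → p (true , c) ≡ true → all p R ≡ true →
    all p (block c b m R) ≡ true
  all-block⁺ p c b m p₀ p₁ allR =
    all-++⁺ p (replicate b _) (all-replicate⁺ p b p₀) (all-++⁺ p (replicate m _) (all-replicate⁺ p m p₁) allR)

  InBlocks≥ : ℕ → List Letter → Bool
  InBlocks≥ c R = all (λ l → c ≤ᵇ proj₂ l) R

  mutual
    sorted-inBlocks≥ : ∀ {n} s c b m (σ B : Vec Bool n) c′ → c′ ≤ c → InBlocks≥ c′ (sortedLetters s c b m σ B) ≡ true
    sorted-inBlocks≥ s c b m []      []      c′ c′≤c = all-block⁺ _ c b m (≤⇒≤ᵇ≡true c′≤c) (≤⇒≤ᵇ≡true c′≤c) refl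
    sorted-inBlocks≥ s c b m (y ∷ σ) (x ∷ B) c′ c′≤c = sorted-close-inBlocks≥ (step s y x) c _ _ σ B c′ c′≤c

    sorted-close-inBlocks≥ : ∀ {n} s c b m (σ B : Vec Bool n) c′ → c′ ≤ c → InBlocks≥ c′ (sortedLetters-close s c b m σ B) ≡ true
    sorted-close-inBlocks≥ zero    c b m σ B c′ c′≤c =
      all-block⁺ _ c b m (≤⇒≤ᵇ≡true c′≤c) (≤⇒≤ᵇ≡true c′≤c) (sorted-inBlocks≥ 0 (suc c) 0 0 σ B c′ (m≤n⇒m≤1+n c′≤c))
    sorted-close-inBlocks≥ (suc s) c b m σ B c′ c′≤c = sorted-inBlocks≥ (suc s) c b m σ B c′ c′≤c

  -- On the sorted word, exchangeability of two letters is exactly the order relation of R_τ.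
  inOrder : Letter → Letter → Bool
  inOrder x y = boolEq (exchangeable x y) (not (proj₁ x) ∧ proj₁ y) ∧ not (exchangeable y x)

  inOrder-laterBlock : ∀ t c (y : Letter) → suc c ≤ proj₂ y → inOrder (t , c) y ≡ true
  inOrder-laterBlock false c (false , c′) c<c′ = refl
  inOrder-laterBlock false c (true  , c′) c<c′ rewrite ≤⇒≤ᵇ≡true (≤-trans (n≤1+n c) c<c′) = refl
  inOrder-laterBlock true  c (false , c′) c<c′ rewrite >⇒≤ᵇ≡false {c′} {c} c<c′ = refl
  inOrder-laterBlock true  c (true  , c′) c<c′ = refl

  block-inOrder : ∀ c b m R → InBlocks≥ (suc c) R ≡ true → pairwise inOrder R ≡ true → pairwise inOrder (block c b m R) ≡ true
  block-inOrder c zero zero R later ordered = ordered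
  block-inOrder c zero (suc m) R later ordered = ∧-true⁺
    (all-++⁺ _ (replicate m _) (all-replicate⁺ _ m refl) (all-mono _ _ R (λ y e → inOrder-laterBlock true c y (≤ᵇ≡true⇒≤ e)) later))
    (block-inOrder c zero m R later ordered)
  block-inOrder c (suc b) m R later ordered = ∧-true⁺
    (all-block⁺ _ c b m refl 0-before-1 (all-mono _ _ R (λ y e → inOrder-laterBlock false c y (≤ᵇ≡true⇒≤ e)) later))
    (block-inOrder c b m R later ordered)
    where
    0-before-1 : inOrder (false , c) (true , c) ≡ true
    0-before-1 rewrite ≤⇒≤ᵇ≡true (≤-refl {c}) = refl

  mutual
    sorted-inOrder : ∀ {n} s c b m (σ B : Vec Bool n) → pairwise inOrder (sortedLetters s c b m σ B) ≡ true
    sorted-inOrder s c b m []      []      = block-inOrder c b m [] refl refl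
    sorted-inOrder s c b m (y ∷ σ) (x ∷ B) = sorted-close-inOrder (step s y x) c _ _ σ B

    sorted-close-inOrder : ∀ {n} s c b m (σ B : Vec Bool n) → pairwise inOrder (sortedLetters-close s c b m σ B) ≡ true
    sorted-close-inOrder zero    c b m σ B =
      block-inOrder c b m _ (sorted-inBlocks≥ 0 (suc c) 0 0 σ B (suc c) ≤-refl) (sorted-inOrder 0 (suc c) 0 0 σ B)
    sorted-close-inOrder (suc s) c b m σ B = sorted-inOrder (suc s) c b m σ B

  respects≡ascends : ∀ x y u u′ → inOrder x y ≡ true → respects (x , u) (y , u′) ≡ ascends (proj₁ x , u) (proj₁ y , u′)
  respects≡ascends (true  , c) (true  , c′) u u′ _ = refl
  respects≡ascends (true  , c) (false , c′) u u′ _ with c′ ≤ᵇ c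
  ... | false = refl
  respects≡ascends (false , c) (true  , c′) u u′ _ with c ≤ᵇ c′
  ... | true = ∧-identityʳ _
  respects≡ascends (false , c) (false , c′) u u′ _ = refl

  ordered⇒respects≡ascends : ∀ (w : List Letter) (us : List ℕ) → pairwise inOrder w ≡ true →
    pairwise respects (zip w us) ≡ pairwise ascends (zip (List.map proj₁ w) us)
  ordered⇒respects≡ascends []      us       _       = refl
  ordered⇒respects≡ascends (x ∷ w) []       _       = refl
  ordered⇒respects≡ascends (x ∷ w) (u ∷ us) ordered =
    cong₂ _∧_ (headAgrees w us (proj₁ (∧-true⁻ ordered))) (ordered⇒respects≡ascends w us (proj₂ (∧-true⁻ ordered)))
    where
    headAgrees : ∀ w us → all (inOrder x) w ≡ true →
      all (respects (x , u)) (zip w us) ≡ all (ascends (proj₁ x , u)) (zip (List.map proj₁ w) us)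
    headAgrees []      us        _   = refl
    headAgrees (y ∷ w) []        _   = refl
    headAgrees (y ∷ w) (u′ ∷ us) all′ =
      cong₂ _∧_ (respects≡ascends x y u u′ (proj₁ (∧-true⁻ all′))) (headAgrees w us (proj₂ (∧-true⁻ all′)))

  bits : ℕ → ℕ → List Bool → List Bool
  bits z o R = replicate z false ++ replicate o true ++ R

  -- The bits of τ_B: block by block, as many 0s as σ has zeros in the block (z), then its ones (o).
  mutual
    typeBits : ∀ {n} → ℕ → ℕ → ℕ → Vec Bool n → Vec Bool n → List Bool
    typeBits s z o []      []      = bits z o []
    typeBits s z o (y ∷ σ) (x ∷ B) = typeBits-close (step s y x) (z + 𝟙 (not y)) (o + 𝟙 y) σ B

    typeBits-close : ∀ {n} → ℕ → ℕ → ℕ → Vec Bool n → Vec Bool n → List Bool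
    typeBits-close zero    z o σ B = bits z o (typeBits 0 0 0 σ B)
    typeBits-close (suc s) z o σ B = typeBits (suc s) z o σ B

  slack-step : ∀ {n} s y x (σ B : Vec Bool n) {k} → slack s (y ∷ σ) (x ∷ B) ≡ just k → slack (step s y x) σ B ≡ just k
  slack-step s y false σ B e = e
  slack-step s y true  σ B e with grow y s
  ... | suc _ = e

  step-balance : ∀ {n} s y x (σ B : Vec Bool n) {k} → slack s (y ∷ σ) (x ∷ B) ≡ just k →
    step s y x + 𝟙 x ≡ s + 𝟙 (not y) × step s y x + 𝟙 y ≡ s + 𝟙 (not x)
  step-balance s       false false σ B _ =
    trans (+-identityʳ (suc s)) (sym (+-comm s 1)) , trans (+-identityʳ (suc s)) (sym (+-comm s 1))
  step-balance s       true  false σ B _ = refl , refl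
  step-balance s       false true  σ B _ = refl , refl
  step-balance (suc s) true  true  σ B _ =
    trans (+-comm s 1) (sym (+-identityʳ (suc s))) , trans (+-comm s 1) (sym (+-identityʳ (suc s)))

  +-transfer : ∀ a b c i j → a + i ≡ c + j → c + b + j ≡ a + (b + i)
  +-transfer a b c i j a+i≡c+j = begin
    c + b + j   ≡⟨ +-assoc c b j ⟩
    c + (b + j) ≡⟨ cong (c +_) (+-comm b j) ⟩
    c + (j + b) ≡⟨ +-assoc c j b ⟨
    c + j + b   ≡⟨ cong (_+ b) a+i≡c+j ⟨
    a + i + b   ≡⟨ +-assoc a i b ⟩
    a + (i + b) ≡⟨ cong (a +_) (+-comm i b) ⟩
    a + (b + i) ∎
    where open ≡-Reasoning

  map-block : ∀ c b m R → List.map proj₁ (block c b m R) ≡ bits b m (List.map proj₁ R)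
  map-block c b m R = begin
    List.map proj₁ (replicate b (false , c) ++ replicate m (true , c) ++ R)
      ≡⟨ map-++ proj₁ (replicate b _) _ ⟩
    List.map proj₁ (replicate b (false , c)) ++ List.map proj₁ (replicate m (true , c) ++ R)
      ≡⟨ cong₂ _++_ (map-replicate proj₁ b _) (map-++ proj₁ (replicate m _) R) ⟩
    replicate b false ++ List.map proj₁ (replicate m (true , c)) ++ List.map proj₁ R
      ≡⟨ cong (λ xs → replicate b false ++ xs ++ List.map proj₁ R) (map-replicate proj₁ m _) ⟩
    bits b m (List.map proj₁ R) ∎
    where open ≡-Reasoning

  mutual
    sorted-types : ∀ {n} s c b m z o (σ B : Vec Bool n) → slack s σ B ≡ just 0 → z ≡ s + b → m ≡ s + o →
      List.map proj₁ (sortedLetters s c b m σ B) ≡ typeBits s z o σ B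
    sorted-types s c b m z o []      []      refl refl refl = map-block c b m []
    sorted-types s c b m z o (y ∷ σ) (x ∷ B) e    refl refl =
      sorted-types-close (step s y x) c _ _ _ _ σ B (slack-step s y x σ B e)
        (+-transfer (step s y x) b s (𝟙 x) (𝟙 (not y)) (proj₁ balance))
        (+-transfer (step s y x) o s (𝟙 y) (𝟙 (not x)) (proj₂ balance))
      where balance = step-balance s y x σ B e

    sorted-types-close : ∀ {n} s c b m z o (σ B : Vec Bool n) → slack s σ B ≡ just 0 → z ≡ s + b → m ≡ s + o →
      List.map proj₁ (sortedLetters-close s c b m σ B) ≡ typeBits-close s z o σ B
    sorted-types-close zero    c b m z o σ B e refl refl =
      trans (map-block c b m _) (cong (bits b m) (sorted-types 0 (suc c) 0 0 0 0 σ B e refl refl))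
    sorted-types-close (suc s) c b m z o σ B e z≡ m≡ = sorted-types (suc s) c b m z o σ B e z≡ m≡

  𝟙-not+𝟙 : ∀ y → 𝟙 (not y) + 𝟙 y ≡ 1
  𝟙-not+𝟙 false = refl
  𝟙-not+𝟙 true  = refl

  length-bits : ∀ z o R → List.length (bits z o R) ≡ z + o + List.length R
  length-bits z o R = begin
    List.length (replicate z false ++ replicate o true ++ R)
      ≡⟨ length-++ (replicate z false) ⟩
    List.length (replicate z false) + List.length (replicate o true ++ R)
      ≡⟨ cong₂ _+_ (length-replicate z) (length-++ (replicate o true)) ⟩
    z + (List.length (replicate o true) + List.length R)
      ≡⟨ cong (λ k → z + (k + List.length R)) (length-replicate o) ⟩
    z + (o + List.length R)
      ≡⟨ +-assoc z o _ ⟨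
    z + o + List.length R ∎
    where open ≡-Reasoning

  mutual
    length-typeBits : ∀ {n} s z o (σ B : Vec Bool n) → List.length (typeBits s z o σ B) ≡ z + o + n
    length-typeBits s z o []      []      = length-bits z o []
    length-typeBits {suc n} s z o (y ∷ σ) (x ∷ B) =
      trans (length-typeBits-close (step s y x) (z + 𝟙 (not y)) (o + 𝟙 y) σ B)
            (trans (rearrange z (𝟙 (not y)) o (𝟙 y) n) (cong (λ k → z + o + (k + n)) (𝟙-not+𝟙 y)))
      where
      rearrange : ∀ z a o b n → z + a + (o + b) + n ≡ z + o + (a + b + n)
      rearrange = solve-∀

    length-typeBits-close : ∀ {n} s z o (σ B : Vec Bool n) → List.length (typeBits-close s z o σ B) ≡ z + o + n
    length-typeBits-close zero    z o σ B = trans (length-bits z o _) (cong (z + o +_) (length-typeBits 0 0 0 σ B))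
    length-typeBits-close (suc s) z o σ B = length-typeBits (suc s) z o σ B

  baseType : ∀ {n} → Vec Bool n → Vec Bool n → Vec Bool n
  baseType σ B = cast (length-typeBits 0 0 0 σ B) (fromList (typeBits 0 0 0 σ B))

  coefficient : ∀ {n} → Vec Bool n → Vec Bool n → ℕ
  coefficient σ τ = # (λ B → zeroSlack σ B ∧ listEq (toList (baseType σ B)) (toList τ))

  toList-baseType : ∀ {n} (σ B : Vec Bool n) → toList (baseType σ B) ≡ typeBits 0 0 0 σ B
  toList-baseType σ B = trans (toList-cast _ (fromList (typeBits 0 0 0 σ B))) (toList∘fromList _)

  length-letters : ∀ {n} s c (σ B : Vec Bool n) → List.length (letters s c σ B) ≡ n
  length-letters s c []      []      = refl
  length-letters s c (y ∷ σ) (x ∷ B) = cong suc (length-letters _ _ σ B)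

  respects-sym : ∀ p q → respects p q ≡ respects q p
  respects-sym (x , v) (y , u) = ∧-comm (not (exchangeable x y) ∨ (v <ᵇ u)) _

  -- Sorting the letters block by block turns the local condition at B into the condition for an
  -- (R_τ, γ)-partition, τ = τ_B.
  ∑-local≡coeffR : ∀ {n} (σ B : Vec Bool n) α γ → slack 0 σ B ≡ just 0 → StrictLabelling (baseType σ B) γ →
    ∑ (allMaps n (List.length α)) (λ f → 𝟙 (hasContent α f ∧ localᵇ σ B f)) ≡ coeffR (baseType σ B) γ α
  ∑-local≡coeffR {n} σ B α γ base strict = begin
    ∑ maps (λ f → 𝟙 (hasContent α f ∧ localᵇ σ B f))
      ≡⟨ ∑-cong maps (λ f → cong (λ b → 𝟙 (b ∧ localᵇ σ B f)) (contentAux-zip 1 α w f |w|)) ⟩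
    ∑ maps (λ f → 𝟙 (Φ (zip w (toList f))))     ≡⟨ ∑-allMaps-zip k n w |w| Φ ⟩
    #labellings k w Φ                           ≡⟨ #labellings-↭ k w↭w′ Φ Φ-↭ ⟩
    #labellings k w′ Φ                          ≡⟨ ∑-allMaps-zip k n w′ |w′| Φ ⟨
    ∑ maps (λ f → 𝟙 (Φ (zip w′ (toList f))))    ≡⟨ ∑-cong maps (λ f → cong 𝟙 (Φ≡partition f)) ⟩
    ∑ maps (λ f → 𝟙 (hasContent α f ∧ partitionᵇ τ γ f)) ≡⟨ length-filterᵇ _ maps ⟨
    coeffR τ γ α                                ∎
    where
    open ≡-Reasoning
    k = List.length α
    maps = allMaps n k
    τ = baseType σ B
    w = letters 0 0 σ B
    w′ = sortedLetters 0 0 0 0 σ B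
    w↭w′ = letters↭sorted 0 0 0 0 σ B
    |w| = length-letters 0 0 σ B
    |w′| = trans (sym (↭-length w↭w′)) |w|
    Φ : List (Letter × ℕ) → Bool
    Φ zs = hasContentᴸ 1 α zs ∧ pairwise respects zs
    Φ-↭ : ↭-Invariant Φ
    Φ-↭ p = cong₂ _∧_ (hasContentᴸ-↭ 1 α p) (pairwise-↭ respects respects-sym p)
    Φ≡partition : ∀ f → Φ (zip w′ (toList f)) ≡ hasContent α f ∧ partitionᵇ τ γ f
    Φ≡partition f = cong₂ _∧_ (sym (contentAux-zip 1 α w′ f |w′|)) (begin
      pairwise respects (zip w′ (toList f))                   ≡⟨ ordered⇒respects≡ascends w′ (toList f) (sorted-inOrder 0 0 0 0 σ B) ⟩
      pairwise ascends (zip (List.map proj₁ w′) (toList f))   ≡⟨ cong (λ bs → pairwise ascends (zip bs (toList f))) types ⟩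
      pairwise ascends (zip (toList τ) (toList f))            ≡⟨ partition≡ascending τ γ f strict ⟨
      partitionᵇ τ γ f                                        ∎)
      where
      types : List.map proj₁ w′ ≡ toList τ
      types = trans (sorted-types 0 0 0 0 0 0 σ B base refl refl) (sym (toList-baseType σ B))

module Position where
  open Counting
  open Exchange
  open Sorting

  lexᴸ : List Bool → List Bool → Bool
  lexᴸ []      []      = true
  lexᴸ (a ∷ u) (b ∷ v) = (not a ∧ b) ∨ (boolEq a b ∧ lexᴸ u v)
  lexᴸ _       _       = false

  lexLeqᵇ≡lexᴸ : ∀ {n} (u v : Vec Bool n) → lexLeqᵇ u v ≡ lexᴸ (toList u) (toList v)
  lexLeqᵇ≡lexᴸ []      []      = refl
  lexLeqᵇ≡lexᴸ (a ∷ u) (b ∷ v) = cong (λ l → (not a ∧ b) ∨ (boolEq a b ∧ l)) (lexLeqᵇ≡lexᴸ u v)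

  onesL : List Bool → ℕ
  onesL []          = 0
  onesL (false ∷ l) = onesL l
  onesL (true ∷ l)  = suc (onesL l)

  zerosL-∷ʳ : ∀ π y → zerosL (π ++ y ∷ []) ≡ zerosL π + 𝟙 (not y)
  zerosL-∷ʳ []          false = refl
  zerosL-∷ʳ []          true  = refl
  zerosL-∷ʳ (false ∷ π) y     = cong suc (zerosL-∷ʳ π y)
  zerosL-∷ʳ (true ∷ π)  y     = zerosL-∷ʳ π y

  onesL-∷ʳ : ∀ π y → onesL (π ++ y ∷ []) ≡ onesL π + 𝟙 y
  onesL-∷ʳ []          false = refl
  onesL-∷ʳ []          true  = refl
  onesL-∷ʳ (false ∷ π) y     = onesL-∷ʳ π y
  onesL-∷ʳ (true ∷ π)  y     = cong suc (onesL-∷ʳ π y)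

  sorting-lexᴸ : ∀ π R R′ → lexᴸ R R′ ≡ true → lexᴸ (bits (zerosL π) (onesL π) R) (π ++ R′) ≡ true
  sorting-lexᴸ []          R R′ R≤R′ = R≤R′
  sorting-lexᴸ (false ∷ π) R R′ R≤R′ = sorting-lexᴸ π R R′ R≤R′
  sorting-lexᴸ (true ∷ π)  R R′ R≤R′ with zerosL π in z
  ... | zero  = subst (λ k → lexᴸ (bits k (onesL π) R) (π ++ R′) ≡ true) z (sorting-lexᴸ π R R′ R≤R′)
  ... | suc k = refl

  mutual
    typeBits-lexᴸ : ∀ {n} s π (σ B : Vec Bool n) → lexᴸ (typeBits s (zerosL π) (onesL π) σ B) (π ++ toList σ) ≡ true
    typeBits-lexᴸ s π []      []      = sorting-lexᴸ π [] [] refl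
    typeBits-lexᴸ s π (y ∷ σ) (x ∷ B) = subst₂ (λ z o → lexᴸ (typeBits-close (step s y x) z o σ B) (π ++ y ∷ toList σ) ≡ true)
      (zerosL-∷ʳ π y) (onesL-∷ʳ π y)
      (subst (λ R → lexᴸ (typeBits-close (step s y x) (zerosL (π ++ y ∷ [])) (onesL (π ++ y ∷ [])) σ B) R ≡ true)
        (++-assoc π (y ∷ []) (toList σ)) (typeBits-close-lexᴸ (step s y x) (π ++ y ∷ []) σ B))

    typeBits-close-lexᴸ : ∀ {n} s π (σ B : Vec Bool n) → lexᴸ (typeBits-close s (zerosL π) (onesL π) σ B) (π ++ toList σ) ≡ true
    typeBits-close-lexᴸ zero    π σ B = sorting-lexᴸ π (typeBits 0 0 0 σ B) (toList σ) (typeBits-lexᴸ 0 [] σ B)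
    typeBits-close-lexᴸ (suc s) π σ B = typeBits-lexᴸ (suc s) π σ B

  baseType-lex : ∀ {n} (σ B : Vec Bool n) → lexLeqᵇ (baseType σ B) σ ≡ true
  baseType-lex σ B rewrite lexLeqᵇ≡lexᴸ (baseType σ B) σ | toList-baseType σ B = typeBits-lexᴸ 0 [] σ B

  mutual
    typeBits-head : ∀ {n} s z o (σ B : Vec Bool n) → ∃ λ R → typeBits s (suc z) o σ B ≡ false ∷ R
    typeBits-head s z o []      []      = _ , refl
    typeBits-head s z o (y ∷ σ) (x ∷ B) = typeBits-close-head (step s y x) (z + 𝟙 (not y)) (o + 𝟙 y) σ B

    typeBits-close-head : ∀ {n} s z o (σ B : Vec Bool n) → ∃ λ R → typeBits-close s (suc z) o σ B ≡ false ∷ R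
    typeBits-close-head zero    z o σ B = _ , refl
    typeBits-close-head (suc s) z o σ B = typeBits-head (suc s) z o σ B

  startsWith0-toList : ∀ {n} (v : Vec Bool (suc n)) R → toList v ≡ false ∷ R → startsWith0ᵇ v ≡ true
  startsWith0-toList (false ∷ v) R _ = refl

  baseType-startsWith0 : ∀ {n} (σ B : Vec Bool (suc n)) → head σ ≡ false → startsWith0ᵇ (baseType σ B) ≡ true
  baseType-startsWith0 (false ∷ σ) (x ∷ B) refl with R , e ← typeBits-close-head (step 0 false x) 0 0 σ B =
    startsWith0-toList (baseType (false ∷ σ) (x ∷ B)) R (trans (toList-baseType (false ∷ σ) (x ∷ B)) e)

module Diagonal where
  open import Data.Nat using (_*_)
  open Counting
  open Bases
  open Exchange
  open Sorting
  open Position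

  -- fits s p σ B decides, reading from slack s, whether B is a base of type σ: p records that σ
  -- has shown a 1 in the current block, after which a 0 of σ in the same block is fatal.
  mutual
    fits : ∀ {n} → ℕ → Bool → Vec Bool n → Vec Bool n → Bool
    fits s p []      []          = s ≡ᵇ 0
    fits s p (y ∷ σ) (false ∷ B) = not (p ∧ not y) ∧ fits-close (grow y s) (p ∨ y) σ B
    fits s p (y ∷ σ) (true ∷ B)  = not (p ∧ not y) ∧ fits-use (grow y s) (p ∨ y) σ B

    fits-close : ∀ {n} → ℕ → Bool → Vec Bool n → Vec Bool n → Bool
    fits-close zero    p σ B = fits 0 false σ B
    fits-close (suc s) p σ B = fits (suc s) p σ B

    fits-use : ∀ {n} → ℕ → Bool → Vec Bool n → Vec Bool n → Bool
    fits-use zero    p σ B = false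
    fits-use (suc s) p σ B = fits-close s p σ B

  listEq-refl : ∀ l → listEq l l ≡ true
  listEq-refl []          = refl
  listEq-refl (true ∷ l)  = listEq-refl l
  listEq-refl (false ∷ l) = listEq-refl l

  listEq-++ : ∀ P X Y → listEq (P ++ X) (P ++ Y) ≡ listEq X Y
  listEq-++ []          X Y = refl
  listEq-++ (true ∷ P)  X Y = listEq-++ P X Y
  listEq-++ (false ∷ P) X Y = listEq-++ P X Y

  replicate-+ : ∀ {A : Set} a b (x : A) → replicate (a + b) x ≡ replicate a x ++ replicate b x
  replicate-+ zero    b x = refl
  replicate-+ (suc a) b x = cong (x ∷_) (replicate-+ a b x)

  mutual
    typeBits-zeros : ∀ {n} s z o (σ B : Vec Bool n) → ∃ λ R → typeBits s z o σ B ≡ replicate z false ++ R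
    typeBits-zeros s z o []      []      = _ , refl
    typeBits-zeros s z o (y ∷ σ) (x ∷ B) with R , e ← typeBits-close-zeros (step s y x) (z + 𝟙 (not y)) (o + 𝟙 y) σ B =
      replicate (𝟙 (not y)) false ++ R ,
      trans e (trans (cong (_++ R) (replicate-+ z (𝟙 (not y)) false)) (++-assoc (replicate z false) _ R))

    typeBits-close-zeros : ∀ {n} s z o (σ B : Vec Bool n) → ∃ λ R → typeBits-close s z o σ B ≡ replicate z false ++ R
    typeBits-close-zeros zero    z o σ B = _ , refl
    typeBits-close-zeros (suc s) z o σ B = typeBits-zeros (suc s) z o σ B

  0<ᵇn+1 : ∀ n → (0 <ᵇ n + 1) ≡ true
  0<ᵇn+1 zero    = refl
  0<ᵇn+1 (suc n) = refl

  mutual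
    base∧type≡fits : ∀ {n} s z o (σ B : Vec Bool n) →
      isJust0 (slack s σ B) ∧ listEq (typeBits s z o σ B) (bits z o (toList σ)) ≡ fits s (0 <ᵇ o) σ B
    base∧type≡fits zero    z o [] [] = listEq-refl (bits z o [])
    base∧type≡fits (suc s) z o [] [] = refl
    base∧type≡fits s z o (y ∷ σ) (false ∷ B) = base∧type≡fits-step y z o (grow y s) σ B
    base∧type≡fits s z o (y ∷ σ) (true ∷ B) with grow y s
    ... | zero  = sym (∧-zeroʳ (not ((0 <ᵇ o) ∧ not y)))
    ... | suc u = base∧type≡fits-step y z o u σ B

    base∧type≡fits-close : ∀ {n} s z o (σ B : Vec Bool n) →
      isJust0 (slack s σ B) ∧ listEq (typeBits-close s z o σ B) (bits z o (toList σ)) ≡ fits-close s (0 <ᵇ o) σ B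
    base∧type≡fits-close zero z o σ B
      rewrite listEq-++ (replicate z false) (replicate o true ++ typeBits 0 0 0 σ B) (replicate o true ++ toList σ)
            | listEq-++ (replicate o true) (typeBits 0 0 0 σ B) (toList σ) = base∧type≡fits 0 0 0 σ B
    base∧type≡fits-close (suc s) z o σ B = base∧type≡fits (suc s) z o σ B

    base∧type≡fits-step : ∀ {n} y z o s (σ B : Vec Bool n) →
      isJust0 (slack s σ B) ∧ listEq (typeBits-close s (z + 𝟙 (not y)) (o + 𝟙 y) σ B) (bits z o (y ∷ toList σ))
        ≡ not ((0 <ᵇ o) ∧ not y) ∧ fits-close s ((0 <ᵇ o) ∨ y) σ B
    base∧type≡fits-step true z o s σ B
      rewrite +-identityʳ z | sym (replicate-+1-++ o true (toList σ)) | base∧type≡fits-close s z (o + 1) σ B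
            | 0<ᵇn+1 o | ∧-zeroʳ (0 <ᵇ o) | ∨-zeroʳ (0 <ᵇ o) = refl
    base∧type≡fits-step false z zero s σ B
      rewrite sym (replicate-+1-++ z false (toList σ)) = base∧type≡fits-close s (z + 1) 0 σ B
    base∧type≡fits-step false z (suc o) s σ B with R , e ← typeBits-close-zeros s (z + 1) (suc o + 0) σ B
      rewrite e | replicate-+1-++ z false R
            | listEq-++ (replicate z false) (false ∷ R) (replicate (suc o) true ++ false ∷ toList σ) =
      ∧-zeroʳ _

  mutual
    fitCount : ℕ → Bool → List Bool → ℕ
    fitCount s p []       = 𝟙 (s ≡ᵇ 0)
    fitCount s p (y ∷ ys) = if p ∧ not y then 0 else fitCount-close (grow y s) (p ∨ y) ys + fitCount-use (grow y s) (p ∨ y) ys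

    fitCount-close : ℕ → Bool → List Bool → ℕ
    fitCount-close zero    p ys = fitCount 0 false ys
    fitCount-close (suc s) p ys = fitCount (suc s) p ys

    fitCount-use : ℕ → Bool → List Bool → ℕ
    fitCount-use zero    p ys = 0
    fitCount-use (suc s) p ys = fitCount-close s p ys

  mutual
    #fits≡fitCount : ∀ {n} s p (σ : Vec Bool n) → # (fits s p σ) ≡ fitCount s p (toList σ)
    #fits≡fitCount s p [] = +-identityʳ _
    #fits≡fitCount {suc n} s p (y ∷ σ) rewrite #-∷ (fits s p (y ∷ σ)) with p ∧ not y
    ... | true  = cong₂ _+_ (∑-zero (allSubsets n) _ (λ _ → refl)) (∑-zero (allSubsets n) _ (λ _ → refl))
    ... | false = cong₂ _+_ (#fits-close≡fitCount-close (grow y s) (p ∨ y) σ) (#fits-use≡fitCount-use (grow y s) (p ∨ y) σ)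

    #fits-close≡fitCount-close : ∀ {n} s p (σ : Vec Bool n) → # (fits-close s p σ) ≡ fitCount-close s p (toList σ)
    #fits-close≡fitCount-close zero    p σ = #fits≡fitCount 0 false σ
    #fits-close≡fitCount-close (suc s) p σ = #fits≡fitCount (suc s) p σ

    #fits-use≡fitCount-use : ∀ {n} s p (σ : Vec Bool n) → # (fits-use s p σ) ≡ fitCount-use s p (toList σ)
    #fits-use≡fitCount-use {n} zero    p σ = ∑-zero (allSubsets n) _ (λ _ → refl)
    #fits-use≡fitCount-use     (suc s) p σ = #fits-close≡fitCount-close s p σ

  -- The rest of the block of σ under way after the letter b: its length, its zeros, and what
  -- follows it (the blocks are cut at every 1 followed by a 0).
  blockLength : Bool → List Bool → ℕ
  blockLength b []       = 0
  blockLength b (y ∷ ys) = if b ∧ not y then 0 else suc (blockLength y ys)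

  blockZeros : Bool → List Bool → ℕ
  blockZeros b []       = 0
  blockZeros b (y ∷ ys) = if b ∧ not y then 0 else 𝟙 (not y) + blockZeros y ys

  afterBlock : Bool → List Bool → Maybe (List Bool)
  afterBlock b []       = nothing
  afterBlock b (y ∷ ys) = if b ∧ not y then just ys else afterBlock y ys

  blockZeros-true : ∀ ys → blockZeros true ys ≡ 0
  blockZeros-true []           = refl
  blockZeros-true (false ∷ ys) = refl
  blockZeros-true (true ∷ ys)  = blockZeros-true ys

  afterBlock-shorter : ∀ b ys {ys′} → afterBlock b ys ≡ just ys′ → List.length ys′ < List.length ys
  afterBlock-shorter b (y ∷ ys) e with b ∧ not y | e
  ... | true  | refl = ≤-refl
  ... | false | e′   = m≤n⇒m≤1+n (afterBlock-shorter y ys e′)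

  fitCountAfter : Maybe (List Bool) → ℕ
  fitCountAfter nothing   = 1
  fitCountAfter (just ys) = fitCount 0 false (false ∷ ys)

  pascal : ℕ → ℕ → ℕ
  pascal n       zero    = 1
  pascal zero    (suc k) = 0
  pascal (suc n) (suc k) = pascal n k + pascal n (suc k)

  pascal≡C : ∀ n k → pascal n k ≡ n C k
  pascal≡C n       zero    = refl
  pascal≡C zero    (suc k) = refl
  pascal≡C (suc n) (suc k) = trans (cong₂ _+_ (pascal≡C n k) (pascal≡C n (suc k))) (nCk+nC[k+1]≡[n+1]C[k+1] n k)

  pascal-*-+ : ∀ r k c → pascal r (suc k) * c + pascal r k * c ≡ pascal (suc r) (suc k) * c
  pascal-*-+ r k c = trans (+-comm (pascal r (suc k) * c) _) (sym (*-distribʳ-+ c (pascal r k) _))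

  -- From slack s, B must take exactly s plus the remaining zeros of the block among its remaining
  -- elements, and any such choice closes the block.
  fitCount-closed : ∀ ys b s →
    fitCount s ((0 <ᵇ s) ∧ b) ys ≡ pascal (blockLength b ys) (s + blockZeros b ys) * fitCountAfter (afterBlock b ys)
  fitCount-closed []           b     zero    = refl
  fitCount-closed []           b     (suc s) with (0 <ᵇ suc s) ∧ b
  ... | _ = refl
  fitCount-closed (false ∷ ys) true  zero    = sym (+-identityʳ (fitCount 0 false (false ∷ ys)))
  fitCount-closed (false ∷ ys) true  (suc s) = refl
  fitCount-closed (true ∷ ys)  b     zero    rewrite ∧-zeroʳ b | fitCount-closed ys true 0 | blockZeros-true ys = +-identityʳ _
  fitCount-closed (true ∷ ys)  b     (suc s) rewrite ∧-zeroʳ b | ∨-zeroʳ b | blockZeros-true ys | +-identityʳ s = afterOne s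
    where
    afterOne : ∀ s → fitCount (suc s) true ys + fitCount-close s true ys
                   ≡ pascal (suc (blockLength true ys)) (suc s) * fitCountAfter (afterBlock true ys)
    afterOne zero    rewrite fitCount-closed ys true 1 | fitCount-closed ys true 0 | blockZeros-true ys =
      pascal-*-+ (blockLength true ys) 0 _
    afterOne (suc s) rewrite fitCount-closed ys true (suc (suc s)) | fitCount-closed ys true (suc s)
                           | blockZeros-true ys | +-identityʳ s = pascal-*-+ (blockLength true ys) (suc s) _
  fitCount-closed (false ∷ ys) false zero    rewrite fitCount-closed ys false 1 | fitCount-closed ys false 0 =
    pascal-*-+ (blockLength false ys) (blockZeros false ys) _
  fitCount-closed (false ∷ ys) false (suc s) rewrite fitCount-closed ys false (suc (suc s)) | fitCount-closed ys false (suc s)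
                                                   | +-suc s (blockZeros false ys) =
    pascal-*-+ (blockLength false ys) (suc (s + blockZeros false ys)) _

  blockProduct : Bool → ℕ → ℕ → List Bool → ℕ
  blockProduct p a z []       = pascal a z
  blockProduct p a z (y ∷ ys) =
    if p ∧ not y then pascal a z * blockProduct y 1 (𝟙 (not y)) ys else blockProduct y (suc a) (𝟙 (not y) + z) ys

  blockProductAfter : Maybe (List Bool) → ℕ
  blockProductAfter nothing   = 1
  blockProductAfter (just ys) = blockProduct false 1 1 ys

  blockProduct-closed : ∀ ys b a z →
    blockProduct b a z ys ≡ pascal (a + blockLength b ys) (z + blockZeros b ys) * blockProductAfter (afterBlock b ys)
  blockProduct-closed []       b a z rewrite +-identityʳ a | +-identityʳ z = sym (*-identityʳ (pascal a z))
  blockProduct-closed (y ∷ ys) b a z with b ∧ not y in e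
  blockProduct-closed (true ∷ ys)  b a z | true rewrite ∧-zeroʳ b with () ← e
  blockProduct-closed (false ∷ ys) b a z | true rewrite +-identityʳ a | +-identityʳ z = refl
  blockProduct-closed (y ∷ ys)     b a z | false
    rewrite blockProduct-closed ys y (suc a) (𝟙 (not y) + z) | +-suc a (blockLength y ys)
          | xy∙z≈y∙xz (𝟙 (not y)) z (blockZeros y ys) = refl

  blockProduct≡fitCount : ∀ ys → blockProduct false 1 1 ys ≡ fitCount 0 false (false ∷ ys)
  blockProduct≡fitCount ys = go ys (<-wellFounded (List.length ys))
    where
    go : ∀ ys → Acc _<_ (List.length ys) → blockProduct false 1 1 ys ≡ fitCount 0 false (false ∷ ys)
    go ys (acc rs) rewrite blockProduct-closed ys false 1 1 | fitCount-closed ys false 1 | fitCount-closed ys false 0 =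
      trans (cong (pascal (suc (blockLength false ys)) (suc (blockZeros false ys)) *_) after)
            (sym (pascal-*-+ (blockLength false ys) (blockZeros false ys) _))
      where
      after : blockProductAfter (afterBlock false ys) ≡ fitCountAfter (afterBlock false ys)
      after with afterBlock false ys in e
      ... | nothing  = refl
      ... | just ys′ = go ys′ (rs (afterBlock-shorter false ys e))

  zerosL-∷ : ∀ y l → zerosL (y ∷ l) ≡ 𝟙 (not y) + zerosL l
  zerosL-∷ false l = refl
  zerosL-∷ true  l = refl

  zerosL-reverse : ∀ l → zerosL (List.reverse l) ≡ zerosL l
  zerosL-reverse []      = refl
  zerosL-reverse (x ∷ l) = begin
    zerosL (List.reverse (x ∷ l))       ≡⟨ cong zerosL (unfold-reverse x l) ⟩
    zerosL (List.reverse l ++ x ∷ [])   ≡⟨ zerosL-∷ʳ (List.reverse l) x ⟩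
    zerosL (List.reverse l) + 𝟙 (not x) ≡⟨ cong (_+ 𝟙 (not x)) (zerosL-reverse l) ⟩
    zerosL l + 𝟙 (not x)                ≡⟨ +-comm (zerosL l) _ ⟩
    𝟙 (not x) + zerosL l                ≡⟨ zerosL-∷ x l ⟨
    zerosL (x ∷ l)                      ∎
    where open ≡-Reasoning

  blockBinomial : List Bool → ℕ
  blockBinomial A = List.length A C zerosL A

  product-blocksAux : ∀ p cur ys →
    product (List.map blockBinomial (blocksAux p cur ys)) ≡ blockProduct p (List.length cur) (zerosL cur) ys
  product-blocksAux p cur [] rewrite length-reverse cur | zerosL-reverse cur | *-identityʳ (List.length cur C zerosL cur) =
    sym (pascal≡C (List.length cur) (zerosL cur))
  product-blocksAux p cur (y ∷ ys) with p ∧ not y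
  ... | true  rewrite product-blocksAux y (y ∷ []) ys | zerosL-reverse cur | length-reverse cur
                    | pascal≡C (List.length cur) (zerosL cur) | zerosL-∷ y [] | +-identityʳ (𝟙 (not y)) = refl
  ... | false rewrite product-blocksAux y (y ∷ cur) ys | zerosL-∷ y cur = refl

  coefficient-diagonal : ∀ {m} (σ : Vec Bool (suc m)) → head σ ≡ false → coefficient σ σ ≡ diagCoeff σ
  coefficient-diagonal {m} (false ∷ σ) refl = begin
    coefficient (false ∷ σ) (false ∷ σ)
      ≡⟨ ∑-cong (allSubsets (suc m)) (λ B → cong 𝟙 (trans
           (cong (λ l → zeroSlack (false ∷ σ) B ∧ listEq l (false ∷ toList σ)) (toList-baseType (false ∷ σ) B))
           (base∧type≡fits 0 0 0 (false ∷ σ) B))) ⟩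
    # (fits 0 false (false ∷ σ))                              ≡⟨ #fits≡fitCount 0 false (false ∷ σ) ⟩
    fitCount 0 false (false ∷ toList σ)                       ≡⟨ blockProduct≡fitCount (toList σ) ⟨
    blockProduct false 1 1 (toList σ)                         ≡⟨ product-blocksAux false (false ∷ []) (toList σ) ⟨
    diagCoeff (false ∷ σ)                                     ∎
    where open ≡-Reasoning

module Expansion where
  open import Data.Nat using (_*_)
  open Counting
  open Bases
  open Exchange
  open Sorting

  module _ {n} (σ : Vec Bool n) where

    isBelow : Vec Bool n → Bool
    isBelow τ = startsWith0ᵇ τ ∧ lexLeqᵇ τ σ

    ∑-byType : (∀ B → isBelow (baseType σ B) ≡ true) → ∀ (g : Vec Bool n → ℕ) →
      ∑ (allSubsets n) (λ B → 𝟙 (zeroSlack σ B) * g (baseType σ B)) ≡ ∑ (below σ) (λ τ → coefficient σ τ * g τ)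
    ∑-byType typeBelow g = sym (begin
      ∑ (below σ) (λ τ → coefficient σ τ * g τ)
        ≡⟨ ∑-filterᵇ isBelow (allSubsets n) _ ⟩
      ∑ subsets (λ τ → 𝟙 (isBelow τ) * (coefficient σ τ * g τ))
        ≡⟨ ∑-cong subsets (λ τ → cong (𝟙 (isBelow τ) *_) (∑-*ʳ subsets (g τ) _)) ⟨
      ∑ subsets (λ τ → 𝟙 (isBelow τ) * ∑ subsets (λ B → 𝟙 (zeroSlack σ B ∧ hasType B τ) * g τ))
        ≡⟨ ∑-cong subsets (λ τ → ∑-*ˡ subsets (𝟙 (isBelow τ)) _) ⟨
      ∑ subsets (λ τ → ∑ subsets (λ B → 𝟙 (isBelow τ) * (𝟙 (zeroSlack σ B ∧ hasType B τ) * g τ)))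
        ≡⟨ ∑-comm subsets subsets _ ⟩
      ∑ subsets (λ B → ∑ subsets (λ τ → 𝟙 (isBelow τ) * (𝟙 (zeroSlack σ B ∧ hasType B τ) * g τ)))
        ≡⟨ ∑-cong subsets (λ B → ∑-cong subsets (λ τ → regroup (isBelow τ) (zeroSlack σ B) (hasType B τ) (g τ))) ⟩
      ∑ subsets (λ B → ∑ subsets (λ τ → 𝟙 (zeroSlack σ B) * (𝟙 (hasType B τ) * (𝟙 (isBelow τ) * g τ))))
        ≡⟨ ∑-cong subsets (λ B → ∑-*ˡ subsets (𝟙 (zeroSlack σ B)) _) ⟩
      ∑ subsets (λ B → 𝟙 (zeroSlack σ B) * ∑ subsets (λ τ → 𝟙 (hasType B τ) * (𝟙 (isBelow τ) * g τ)))
        ≡⟨ ∑-cong subsets (λ B → cong (𝟙 (zeroSlack σ B) *_) (∑-select n (baseType σ B) _)) ⟩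
      ∑ subsets (λ B → 𝟙 (zeroSlack σ B) * (𝟙 (isBelow (baseType σ B)) * g (baseType σ B)))
        ≡⟨ ∑-cong subsets (λ B → cong (λ b → 𝟙 (zeroSlack σ B) * (𝟙 b * g (baseType σ B))) (typeBelow B)) ⟩
      ∑ subsets (λ B → 𝟙 (zeroSlack σ B) * (1 * g (baseType σ B)))
        ≡⟨ ∑-cong subsets (λ B → cong (𝟙 (zeroSlack σ B) *_) (*-identityˡ _)) ⟩
      ∑ subsets (λ B → 𝟙 (zeroSlack σ B) * g (baseType σ B)) ∎)
      where
      open ≡-Reasoning
      subsets = allSubsets n
      hasType : Vec Bool n → Vec Bool n → Bool
      hasType B τ = listEq (toList (baseType σ B)) (toList τ)
      regroup : ∀ p z h g → 𝟙 p * (𝟙 (z ∧ h) * g) ≡ 𝟙 z * (𝟙 h * (𝟙 p * g))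
      regroup p z h g rewrite 𝟙-∧ z h = rearrange (𝟙 p) (𝟙 z) (𝟙 h) g
        where
        rearrange : ∀ p z h g → p * (z * h * g) ≡ z * (h * (p * g))
        rearrange = solve-∀

    coeffM-expansion : ∀ α (γ : Vec Bool n → Fin n → Fin n) → (∀ B → isBelow (baseType σ B) ≡ true) →
      (∀ B → StrictLabelling (baseType σ B) (γ (baseType σ B))) →
      coeffM σ α ≡ ∑ (below σ) (λ τ → coefficient σ τ * coeffR τ (γ τ) α)
    coeffM-expansion α γ typeBelow strict = begin
      coeffM σ α
        ≡⟨ length-filterᵇ _ maps ⟩
      ∑ maps (λ f → 𝟙 (hasContent α f ∧ genericᵇ σ f))
        ≡⟨ ∑-cong maps (λ f → trans (𝟙-∧ (hasContent α f) _) (cong (𝟙 (hasContent α f) *_) (𝟙-generic σ f))) ⟩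
      ∑ maps (λ f → 𝟙 (hasContent α f) * # (isLocalBase σ f))
        ≡⟨ ∑-cong maps (λ f → ∑-*ˡ subsets (𝟙 (hasContent α f)) _) ⟨
      ∑ maps (λ f → ∑ subsets (λ B → 𝟙 (hasContent α f) * 𝟙 (isLocalBase σ f B)))
        ≡⟨ ∑-comm maps subsets _ ⟩
      ∑ subsets (λ B → ∑ maps (λ f → 𝟙 (hasContent α f) * 𝟙 (zeroSlack σ B ∧ localᵇ σ B f)))
        ≡⟨ ∑-cong subsets (λ B → ∑-cong maps (λ f → 𝟙-swap (hasContent α f) (zeroSlack σ B) _)) ⟩
      ∑ subsets (λ B → ∑ maps (λ f → 𝟙 (zeroSlack σ B) * 𝟙 (hasContent α f ∧ localᵇ σ B f)))
        ≡⟨ ∑-cong subsets (λ B → ∑-*ˡ maps (𝟙 (zeroSlack σ B)) _) ⟩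
      ∑ subsets (λ B → 𝟙 (zeroSlack σ B) * ∑ maps (λ f → 𝟙 (hasContent α f ∧ localᵇ σ B f)))
        ≡⟨ ∑-cong subsets perBase ⟩
      ∑ subsets (λ B → 𝟙 (zeroSlack σ B) * coeffR (baseType σ B) (γ (baseType σ B)) α)
        ≡⟨ ∑-byType typeBelow (λ τ → coeffR τ (γ τ) α) ⟩
      ∑ (below σ) (λ τ → coefficient σ τ * coeffR τ (γ τ) α) ∎
      where
      open ≡-Reasoning
      subsets = allSubsets n
      maps = allMaps n (List.length α)
      perBase : ∀ B → 𝟙 (zeroSlack σ B) * ∑ maps (λ f → 𝟙 (hasContent α f ∧ localᵇ σ B f))
                    ≡ 𝟙 (zeroSlack σ B) * coeffR (baseType σ B) (γ (baseType σ B)) α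
      perBase B with zeroSlack σ B in base
      ... | false = refl
      ... | true  = cong (1 *_) (∑-local≡coeffR σ B α _ (isJust0⇒≡ _ base) (strict B))

  sumℤ-+ : ∀ {n} (ts : List (Vec Bool n)) (a b : Vec Bool n → ℕ) →
    sumℤ ts (λ τ → ℤ.+ a τ ℤ.* ℤ.+ b τ) ≡ ℤ.+ ∑ ts (λ τ → a τ * b τ)
  sumℤ-+ []       a b = refl
  sumℤ-+ (t ∷ ts) a b = trans (cong₂ ℤ._+_ (sym (pos-* (a t) (b t))) (sumℤ-+ ts a b)) (sym (pos-+ (a t * b t) _))

open import Data.Integer using (ℤ; +_; _*_)
open Booleans using (∧-true⁺)
open Sorting using (baseType; coefficient)
open Expansion using (coeffM-expansion; sumℤ-+)
open Position using (baseType-lex; baseType-startsWith0)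
open Diagonal using (coefficient-diagonal)

proposition10p6 : (m : ℕ) (σ : Vec Bool (suc m)) → head σ ≡ false →
    Σ (Vec Bool (suc m) → ℤ) (λ c →
      ((γ : Vec Bool (suc m) → Fin (suc m) → Fin (suc m)) →
       ((τ : Vec Bool (suc m)) → T (startsWith0ᵇ τ) → T (lexLeqᵇ τ σ) → StrictLabelling τ (γ τ)) →
       (α : List ℕ) →
       + coeffM σ α ≡ sumℤ (below σ) (λ τ → c τ * + coeffR τ (γ τ) α))
      × (c σ ≡ + diagCoeff σ))
proposition10p6 m σ σ₀ = (λ τ → + coefficient σ τ) , expansion , cong +_ (coefficient-diagonal σ σ₀)
  where
  startsWith0 : ∀ B → startsWith0ᵇ (baseType σ B) ≡ true
  startsWith0 B = baseType-startsWith0 σ B σ₀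
  expansion : ∀ γ → (∀ τ → T (startsWith0ᵇ τ) → T (lexLeqᵇ τ σ) → StrictLabelling τ (γ τ)) → ∀ α →
    + coeffM σ α ≡ sumℤ (below σ) (λ τ → + coefficient σ τ * + coeffR τ (γ τ) α)
  expansion γ strict α = trans
    (cong +_ (coeffM-expansion σ α γ (λ B → ∧-true⁺ (startsWith0 B) (baseType-lex σ B))
      (λ B → strict (baseType σ B) (from T-≡ (startsWith0 B)) (from T-≡ (baseType-lex σ B)))))
    (sym (sumℤ-+ (below σ) (coefficient σ) (λ τ → coeffR τ (γ τ) α)))
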